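{- Let $n$ be a positive integer and let $S\subseteq[n]$ be a non-empty $n$-admissible set with $m=\max(S)$, and let $p_S(x)$ be its peak polynomial. Then $(\Delta^j p_S)(k)>0$ for all integers $1\leq j\leq m-1$ and all integers $k\geq m$, and $(\Delta^m p_S)(x)=0$ identically.
   Context: For a positive integer $n$, $[n]=\{1,\dots,n\}$ and $\mathfrak{S}_n$ is the symmetric group, with $\pi\in\mathfrak{S}_n$ written in one-line notation $\pi=\pi_1\pi_2\cdots\pi_n$. A permutation $\pi$ has a peak at index $i$ (necessarily $2\le i\le n-1$) if $\pi_{i-1}<\pi_i>\pi_{i+1}$; $\mathcal{P}(\pi)$ is the set of indices at which $\pi$ has a peak. For $S\subseteq[n]$, $\mathcal{P}_S(n)=\{\pi\in\mathfrak{S}_n:\mathcal{P}(\pi)=S\}$, and $S$ is called $n$-admissible if $\mathcal{P}_S(n)\neq\emptyset$ (then $S$ is $k$-admissible for every $k\ge n$). By a result of Billey, Burdzy and Sagan, for each set $S$ that is admissible for some $n$ there is a polynomial $p_S(x)$ (the peak polynomial of $S$), of degree $\max(S)-1$ when $S\neq\emptyset$, such that $|\mathcal{P}_S(n)|=p_S(n)\,2^{n-|S|-1}$ for every $n$ for which $S$ is $n$-admissible. The forward difference operator is $(\Delta f)(x)=f(x+1)-f(x)$, with $\Delta^j f=\Delta(\Delta^{j-1}f)$ and $\Delta^0 f=f$. -}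

module Defs where

open import Data.Nat as ℕ using (ℕ; zero; suc; _∸_)
open import Data.Integer using (+_)
open import Data.Rational using (ℚ; _/_; _+_; _-_; _*_; 0ℚ; 1ℚ)
open import Data.List using (List; []; _∷_; length; applyUpTo)
open import Data.List.Membership.Propositional using (_∈_)
open import Data.List.Relation.Unary.Unique.Propositional using (Unique)
open import Data.List.Relation.Binary.Permutation.Propositional using (_↭_)
open import Data.Product using (Σ; ∃; _×_)
open import Function.Bundles using (_⇔_)

ℕtoℚ : ℕ → ℚ
ℕtoℚ k = + k / 1

-- 1-based access to a list (default 0 outside the range; only used in range)
at : List ℕ → ℕ → ℕ
at []       _             = 0
at (x ∷ xs) zero          = 0
at (x ∷ xs) (suc zero)    = x
at (x ∷ xs) (suc (suc i)) = at xs (suc i)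

-- one-line notation π = π₁ ⋯ π_N is a permutation of [N] = {1,…,N}
IsPerm : ℕ → List ℕ → Set
IsPerm N π = π ↭ applyUpTo suc N

IsPeak : List ℕ → ℕ → Set
IsPeak π i = (2 ℕ.≤ i) × (suc i ℕ.≤ length π)
           × (at π (i ∸ 1) ℕ.< at π i) × (at π (suc i) ℕ.< at π i)

HasPeakSet : List ℕ → List ℕ → Set
HasPeakSet π S = ∀ i → IsPeak π i ⇔ (i ∈ S)

Admissible : List ℕ → ℕ → Set
Admissible S N = ∃ λ π → IsPerm N π × HasPeakSet π S

-- L is a duplicate-free enumeration of 𝒫_S(N), so |𝒫_S(N)| = length L
Enumerates : List ℕ → ℕ → List (List ℕ) → Set
Enumerates S N L = Unique L × (∀ π → (π ∈ L) ⇔ (IsPerm N π × HasPeakSet π S))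

-- polynomials with rational coefficients (constant term first), Horner evaluation
Poly : Set
Poly = List ℚ

eval : Poly → ℚ → ℚ
eval []       x = 0ℚ
eval (c ∷ cs) x = c + x * eval cs x

pow2 : ℕ → ℚ
pow2 zero    = 1ℚ
pow2 (suc k) = ℕtoℚ 2 * pow2 k

-- p is the peak polynomial of S (S duplicate-free, |S| = length S):
-- |𝒫_S(N)| = p(N) 2^{N-|S|-1} whenever S is N-admissible
IsPeakPoly : List ℕ → Poly → Set
IsPeakPoly S p = ∀ N → Admissible S N → ∀ L → Enumerates S N L →
  ℕtoℚ (length L) ≡ eval p (ℕtoℚ N) * pow2 (N ∸ length S ∸ 1)
  where open import Relation.Binary.PropositionalEquality using (_≡_)

Δ : (ℚ → ℚ) → (ℚ → ℚ)
Δ f x = f (x + 1ℚ) - f x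

Δ^ : ℕ → (ℚ → ℚ) → (ℚ → ℚ)
Δ^ zero    f = f
Δ^ (suc j) f = Δ (Δ^ j f)

module Submission where

-- Inserting the letter N + 1 into a permutation of [N] gives the Billey–Burdzy–Sagan recursion:
-- for every N ≥ max S,
--   p_S(N + 1) − p_S(N) = ∑_{s ∈ S} (p_{S∖s}(N) + p_{S↓s}(N)),
-- where S∖s deletes s and S↓s replaces s by s − 1, both shifting the elements above s down by
-- one (a child that is not admissible contributes 0). Every child has maximum at most m − 1,
-- and some child has maximum exactly m − 1 (or m = 2). Induction on m then shows that on
-- [m, ∞) all differences of p_S are non-negative, Δ^j p_S > 0 for 1 ≤ j < m and Δ^m p_S = 0.
-- The given polynomial agrees with this combinatorial p_S on all N > m, so Δ^m p vanishes at
-- infinitely many points and hence everywhere; this in turn forces agreement at N = m.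

module ListSum where

  open import Data.Nat using (ℕ; _+_; _*_)
  open import Data.Nat.Properties using (+-commutativeSemigroup; *-zeroʳ; *-distribˡ-+; *-distribʳ-+)
  open import Algebra.Properties.CommutativeSemigroup +-commutativeSemigroup using (interchange)
  open import Data.Nat.ListAction using (sum)
  open import Data.Nat.ListAction.Properties using (sum-++; sum-↭)
  open import Data.List using (List; []; _∷_; _++_; map; concatMap)
  open import Data.List.Properties using (map-++; map-∘)
  open import Data.List.Membership.Propositional using (_∈_)
  open import Data.List.Relation.Unary.Any using (here; there)
  open import Data.List.Relation.Binary.Permutation.Propositional using (_↭_)
  import Data.List.Relation.Binary.Permutation.Propositional.Properties as ↭
  open import Relation.Binary.PropositionalEquality using (_≡_; refl; sym; trans; cong; cong₂)

  ∑ : {A : Set} → List A → (A → ℕ) → ℕ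
  ∑ xs f = sum (map f xs)

  ∑-++ : {A : Set} (xs ys : List A) (f : A → ℕ) → ∑ (xs ++ ys) f ≡ ∑ xs f + ∑ ys f
  ∑-++ xs ys f = trans (cong sum (map-++ f xs ys)) (sum-++ (map f xs) (map f ys))

  ∑-map : {A B : Set} (g : A → B) (xs : List A) (f : B → ℕ) → ∑ (map g xs) f ≡ ∑ xs (λ x → f (g x))
  ∑-map g xs f = cong sum (sym (map-∘ xs))

  ∑-concatMap : {A B : Set} (g : A → List B) (xs : List A) (f : B → ℕ) →
                ∑ (concatMap g xs) f ≡ ∑ xs (λ x → ∑ (g x) f)
  ∑-concatMap g [] f = refl
  ∑-concatMap g (x ∷ xs) f = trans (∑-++ (g x) (concatMap g xs) f) (cong (∑ (g x) f +_) (∑-concatMap g xs f))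

  ∑-cong : {A : Set} (xs : List A) {f g : A → ℕ} → (∀ x → x ∈ xs → f x ≡ g x) → ∑ xs f ≡ ∑ xs g
  ∑-cong [] h = refl
  ∑-cong (x ∷ xs) h = cong₂ _+_ (h x (here refl)) (∑-cong xs (λ y y∈ → h y (there y∈)))

  ∑-zero : {A : Set} (xs : List A) {f : A → ℕ} → (∀ x → x ∈ xs → f x ≡ 0) → ∑ xs f ≡ 0
  ∑-zero [] h = refl
  ∑-zero (x ∷ xs) h = cong₂ _+_ (h x (here refl)) (∑-zero xs (λ y y∈ → h y (there y∈)))

  ∑-+ : {A : Set} (xs : List A) (f g : A → ℕ) → ∑ xs (λ x → f x + g x) ≡ ∑ xs f + ∑ xs g
  ∑-+ [] f g = refl
  ∑-+ (x ∷ xs) f g = trans (cong (f x + g x +_) (∑-+ xs f g)) (interchange (f x) (g x) (∑ xs f) (∑ xs g))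

  ∑-comm : {A B : Set} (xs : List A) (ys : List B) (f : A → B → ℕ) →
           ∑ xs (λ x → ∑ ys (f x)) ≡ ∑ ys (λ y → ∑ xs (λ x → f x y))
  ∑-comm [] ys f = sym (∑-zero ys (λ _ _ → refl))
  ∑-comm (x ∷ xs) ys f = trans (cong (∑ ys (f x) +_) (∑-comm xs ys f)) (sym (∑-+ ys (f x) (λ y → ∑ xs (λ x → f x y))))

  ∑-*ˡ : {A : Set} (c : ℕ) (xs : List A) (f : A → ℕ) → ∑ xs (λ x → c * f x) ≡ c * ∑ xs f
  ∑-*ˡ c [] f = sym (*-zeroʳ c)
  ∑-*ˡ c (x ∷ xs) f = trans (cong (c * f x +_) (∑-*ˡ c xs f)) (sym (*-distribˡ-+ c (f x) (∑ xs f)))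

  ∑-*ʳ : {A : Set} (xs : List A) (f : A → ℕ) (c : ℕ) → ∑ xs f * c ≡ ∑ xs (λ x → f x * c)
  ∑-*ʳ [] f c = refl
  ∑-*ʳ (x ∷ xs) f c = trans (*-distribʳ-+ c (f x) (∑ xs f)) (cong (f x * c +_) (∑-*ʳ xs f c))

  ∑-↭ : {A : Set} {xs ys : List A} (f : A → ℕ) → xs ↭ ys → ∑ xs f ≡ ∑ ys f
  ∑-↭ f p = sum-↭ (↭.map⁺ f p)


module Permutations where

  open import Data.Nat using (ℕ; zero; suc; _≤_; _<_; s≤s)
  open import Data.Nat.Properties using (<-irrefl; m≤m+n)
  open import Data.List using (List; []; _∷_; _++_; length; map; concatMap; upTo; applyUpTo)
  open import Data.List.Properties using (applyUpTo-∷ʳ; ∷-injective; length-++; length-applyUpTo)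
  open import Data.List.Membership.Propositional using (_∈_; _∉_; find; lose)
  open import Data.List.Membership.Propositional.Properties
    using (∈-∃++; ∈-map⁺; ∈-map⁻; ∈-upTo⁺; ∈-upTo⁻; ∈-applyUpTo⁻; ∈-concatMap⁺; ∈-concatMap⁻)
  open import Data.List.Relation.Unary.Any using (here; there)
  open import Data.List.Relation.Unary.All using (All; []; _∷_; tabulate)
  import Data.List.Relation.Unary.All as All
  import Data.List.Relation.Unary.All.Properties as All
  open import Data.List.Relation.Unary.AllPairs using ([]; _∷_)
  open import Data.List.Relation.Unary.Unique.Propositional using (Unique)
  open import Data.List.Relation.Unary.Unique.Propositional.Properties using (++⁺; upTo⁺)
  open import Data.List.Relation.Binary.Permutation.Propositional using (_↭_; ↭-sym; ↭-trans; ↭-refl; prep; swap)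
  open import Data.List.Relation.Binary.Permutation.Propositional.Properties
    using (∈-resp-↭; ↭-length; ↭-empty-inv; shift; drop-∷; ∷↭∷ʳ)
  open import Data.Product using (∃; _×_; _,_; proj₁; proj₂)
  open import Relation.Binary.PropositionalEquality using (_≡_; refl; sym; trans; cong; subst)
  open import Relation.Nullary using (contradiction)
  open import Function using (_∘_)

  insertAt : ℕ → ℕ → List ℕ → List ℕ
  insertAt zero    x σ       = x ∷ σ
  insertAt (suc i) x []      = x ∷ []
  insertAt (suc i) x (y ∷ σ) = y ∷ insertAt i x σ

  oneTo : ℕ → List ℕ
  oneTo N = applyUpTo suc N

  insertions : ℕ → List ℕ → List (List ℕ)
  insertions x σ = map (λ i → insertAt i x σ) (upTo x)

  permutations : ℕ → List (List ℕ)
  permutations zero    = [] ∷ []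
  permutations (suc N) = concatMap (insertions (suc N)) (permutations N)

  insertAt-++ : ∀ xs x ys → insertAt (length xs) x (xs ++ ys) ≡ xs ++ x ∷ ys
  insertAt-++ []       x ys = refl
  insertAt-++ (y ∷ xs) x ys = cong (y ∷_) (insertAt-++ xs x ys)

  insertAt-↭ : ∀ i x σ → insertAt i x σ ↭ x ∷ σ
  insertAt-↭ zero    x σ       = ↭-refl
  insertAt-↭ (suc i) x []      = ↭-refl
  insertAt-↭ (suc i) x (y ∷ σ) = ↭-trans (prep y (insertAt-↭ i x σ)) (swap y x ↭-refl)

  oneTo-suc : ∀ N → oneTo (suc N) ↭ suc N ∷ oneTo N
  oneTo-suc N = subst (_↭ suc N ∷ oneTo N) (applyUpTo-∷ʳ suc N) (↭-sym (∷↭∷ʳ (suc N) (oneTo N)))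

  ∈-permutations⁻ : ∀ N {π} → π ∈ permutations N → π ↭ oneTo N
  ∈-permutations⁻ zero (here refl) = ↭-refl
  ∈-permutations⁻ (suc N) π∈ with find (∈-concatMap⁻ (insertions (suc N)) π∈)
  ... | σ , σ∈ , π∈ins with ∈-map⁻ (λ i → insertAt i (suc N) σ) {xs = upTo (suc N)} π∈ins
  ... | i , _ , refl = ↭-trans (insertAt-↭ i (suc N) σ)
                         (↭-trans (prep (suc N) (∈-permutations⁻ N σ∈)) (↭-sym (oneTo-suc N)))

  ∈-permutations⁺ : ∀ N {π} → π ↭ oneTo N → π ∈ permutations N
  ∈-permutations⁺ zero p rewrite ↭-empty-inv p = here refl
  ∈-permutations⁺ (suc N) p with ∈-∃++ (∈-resp-↭ (↭-sym (↭-trans p (oneTo-suc N))) (here refl))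
  ... | xs , ys , refl = ∈-concatMap⁺ (insertions (suc N)) (lose (∈-permutations⁺ N rest↭)
                           (subst (_∈ insertions (suc N) (xs ++ ys)) (insertAt-++ xs (suc N) ys)
                             (∈-map⁺ (λ i → insertAt i (suc N) (xs ++ ys)) (∈-upTo⁺ (s≤s |xs|≤N)))))
    where
    rest↭ : xs ++ ys ↭ oneTo N
    rest↭ = drop-∷ (↭-trans (↭-sym (shift (suc N) xs ys)) (↭-trans p (oneTo-suc N)))
    |xs|≤N : length xs ≤ N
    |xs|≤N = subst (length xs ≤_) (trans (sym (length-++ xs)) (trans (↭-length rest↭) (length-applyUpTo suc N)))
               (m≤m+n (length xs) (length ys))

  permutation-length : ∀ N {σ} → σ ∈ permutations N → length σ ≡ N
  permutation-length N σ∈ = trans (↭-length (∈-permutations⁻ N σ∈)) (length-applyUpTo suc N)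

  permutation-< : ∀ N {σ} → σ ∈ permutations N → All (_< suc N) σ
  permutation-< N σ∈ = tabulate λ x∈ → oneTo-< (∈-resp-↭ (∈-permutations⁻ N σ∈) x∈)
    where
    oneTo-< : ∀ {x} → x ∈ oneTo N → x < suc N
    oneTo-< x∈ with ∈-applyUpTo⁻ suc x∈
    ... | i , i<N , refl = s≤s i<N

  suc∉permutation : ∀ N {σ} → σ ∈ permutations N → suc N ∉ σ
  suc∉permutation N σ∈ x∈ = <-irrefl refl (All.lookup (permutation-< N σ∈) x∈)

  insertAt-injective : ∀ {x} i i' σ σ' → x ∉ σ → x ∉ σ' → i ≤ length σ → i' ≤ length σ' →
                       insertAt i x σ ≡ insertAt i' x σ' → i ≡ i' × σ ≡ σ'
  insertAt-injective zero zero σ σ' _ _ _ _ refl = refl , refl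
  insertAt-injective zero (suc i') σ (y ∷ σ') _ x∉σ' _ _ eq with ∷-injective eq
  ... | refl , _ = contradiction (here refl) x∉σ'
  insertAt-injective (suc i) zero (y ∷ σ) σ' x∉σ _ _ _ eq with ∷-injective eq
  ... | refl , _ = contradiction (here refl) x∉σ
  insertAt-injective (suc i) (suc i') (y ∷ σ) (y' ∷ σ') x∉σ x∉σ' (s≤s i≤) (s≤s i'≤) eq with ∷-injective eq
  ... | refl , eq' with insertAt-injective i i' σ σ' (x∉σ ∘ there) (x∉σ' ∘ there) i≤ i'≤ eq'
  ... | refl , refl = refl , refl

  Unique-map : {A B : Set} (f : A → B) (xs : List A) → Unique xs →
               (∀ {x y} → x ∈ xs → y ∈ xs → f x ≡ f y → x ≡ y) → Unique (map f xs)
  Unique-map f []       _          _   = []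
  Unique-map f (x ∷ xs) (x∉ ∷ u) inj =
    All.map⁺ (All.tabulate (λ y∈ fx≡fy → All.lookup x∉ y∈ (inj (here refl) (there y∈) fx≡fy)))
    ∷ Unique-map f xs u (λ x∈ y∈ → inj (there x∈) (there y∈))

  Unique-concatMap : {A B : Set} (f : A → List B) (xs : List A) → Unique xs → (∀ {x} → x ∈ xs → Unique (f x)) →
                     (∀ {x y z} → x ∈ xs → y ∈ xs → z ∈ f x → z ∈ f y → x ≡ y) → Unique (concatMap f xs)
  Unique-concatMap f []       _          _  _        = []
  Unique-concatMap f (x ∷ xs) (x∉ ∷ u) uf disjoint =
    ++⁺ (uf (here refl)) (Unique-concatMap f xs u (uf ∘ there) (λ x∈ y∈ → disjoint (there x∈) (there y∈)))
      λ { (z∈fx , z∈rest) → let (y , y∈ , z∈fy) = find (∈-concatMap⁻ f z∈rest) in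
          All.lookup x∉ y∈ (disjoint (here refl) (there y∈) z∈fx z∈fy) }

  permutations-unique : ∀ N → Unique (permutations N)
  permutations-unique zero    = [] ∷ []
  permutations-unique (suc N) = Unique-concatMap (insertions (suc N)) (permutations N) (permutations-unique N)
    (λ σ∈ → Unique-map _ (upTo (suc N)) (upTo⁺ (suc N))
              (λ i∈ i'∈ eq → proj₁ (injective σ∈ σ∈ i∈ i'∈ eq)))
    (λ σ∈ σ'∈ z∈ z∈' → disjoint σ∈ σ'∈ (∈-map⁻ _ {xs = upTo (suc N)} z∈) (∈-map⁻ _ {xs = upTo (suc N)} z∈'))
    where
    position-≤ : ∀ {σ i} → σ ∈ permutations N → i ∈ upTo (suc N) → i ≤ length σ
    position-≤ {σ} σ∈ i∈ with ∈-upTo⁻ i∈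
    ... | s≤s i≤N = subst (_ ≤_) (sym (permutation-length N σ∈)) i≤N
    injective : ∀ {σ σ' i i'} → σ ∈ permutations N → σ' ∈ permutations N → i ∈ upTo (suc N) → i' ∈ upTo (suc N) →
                insertAt i (suc N) σ ≡ insertAt i' (suc N) σ' → i ≡ i' × σ ≡ σ'
    injective σ∈ σ'∈ i∈ i'∈ = insertAt-injective _ _ _ _ (suc∉permutation N σ∈) (suc∉permutation N σ'∈)
                                (position-≤ σ∈ i∈) (position-≤ σ'∈ i'∈)
    disjoint : ∀ {σ σ' z} → σ ∈ permutations N → σ' ∈ permutations N →
               ∃ (λ i → i ∈ upTo (suc N) × z ≡ insertAt i (suc N) σ) →
               ∃ (λ i → i ∈ upTo (suc N) × z ≡ insertAt i (suc N) σ') → σ ≡ σ'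
    disjoint σ∈ σ'∈ (i , i∈ , refl) (i' , i'∈ , eq) = proj₂ (injective σ∈ σ'∈ i∈ i'∈ eq)


module PeakIndicator where

  open import Data.Nat using (ℕ; zero; suc; _∸_; _≤_; _<_; z≤n; s≤s; _≤ᵇ_; _<ᵇ_)
  open import Data.Nat.Properties using (≤-trans; ≤-refl; n≤1+n; m∸n≤m; <⇒≤; <⇒≱; <-asym; ≤⇒≤ᵇ; ≤ᵇ⇒≤; <⇒<ᵇ; <ᵇ⇒<)
  open import Data.Bool using (Bool; true; false; _∧_)
  open import Data.Bool.Properties using (∧-zeroʳ; T-≡; ¬-not)
  open import Data.List using (List; []; _∷_; length)
  open import Data.List.Relation.Unary.All using (All; []; _∷_)
  open import Data.Product using (_×_; _,_)
  open import Data.Empty using (⊥)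
  open import Function.Bundles using (Equivalence)
  open import Relation.Binary.PropositionalEquality using (_≡_; refl; sym; trans; cong; subst₂)
  open import Defs using (at; IsPeak)
  open Permutations using (insertAt)

  ≤ᵇ-true : ∀ {m n} → m ≤ n → (m ≤ᵇ n) ≡ true
  ≤ᵇ-true m≤n = Equivalence.to T-≡ (≤⇒≤ᵇ m≤n)

  ≤ᵇ-sound : ∀ {m n} → (m ≤ᵇ n) ≡ true → m ≤ n
  ≤ᵇ-sound {m} {n} eq = ≤ᵇ⇒≤ m n (Equivalence.from T-≡ eq)

  ≤ᵇ-false : ∀ {m n} → n < m → (m ≤ᵇ n) ≡ false
  ≤ᵇ-false {m} {n} n<m = ¬-not λ eq → <⇒≱ n<m (≤ᵇ-sound {m} {n} eq)

  <ᵇ-true : ∀ {m n} → m < n → (m <ᵇ n) ≡ true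
  <ᵇ-true m<n = Equivalence.to T-≡ (<⇒<ᵇ m<n)

  <ᵇ-sound : ∀ {m n} → (m <ᵇ n) ≡ true → m < n
  <ᵇ-sound {m} {n} eq = <ᵇ⇒< m n (Equivalence.from T-≡ eq)

  <ᵇ-false : ∀ {m n} → n ≤ m → (m <ᵇ n) ≡ false
  <ᵇ-false {m} {n} n≤m = ¬-not λ eq → <⇒≱ (<ᵇ-sound {m} {n} eq) n≤m

  ∧-true⁻ : ∀ {a b} → (a ∧ b) ≡ true → a ≡ true × b ≡ true
  ∧-true⁻ {true} {true} _ = refl , refl

  peakᵇ : List ℕ → ℕ → Bool
  peakᵇ π q = (2 ≤ᵇ q) ∧ ((suc q ≤ᵇ length π) ∧ ((at π (q ∸ 1) <ᵇ at π q) ∧ (at π (suc q) <ᵇ at π q)))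

  IsPeak⇒peakᵇ : ∀ π q → IsPeak π q → peakᵇ π q ≡ true
  IsPeak⇒peakᵇ π q (a , b , c , d) rewrite ≤ᵇ-true a | ≤ᵇ-true b | <ᵇ-true c | <ᵇ-true d = refl

  peakᵇ⇒IsPeak : ∀ π q → peakᵇ π q ≡ true → IsPeak π q
  peakᵇ⇒IsPeak π q eq with ∧-true⁻ {2 ≤ᵇ q} eq
  ... | e₁ , e₂ with ∧-true⁻ {suc q ≤ᵇ length π} e₂
  ... | e₃ , e₄ with ∧-true⁻ {at π (q ∸ 1) <ᵇ at π q} e₄
  ... | e₅ , e₆ = ≤ᵇ-sound e₁ , ≤ᵇ-sound e₃ , <ᵇ-sound e₅ , <ᵇ-sound e₆

  peakᵇ-≤right : ∀ π q → at π q ≤ at π (suc q) → peakᵇ π q ≡ false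
  peakᵇ-≤right π q h rewrite <ᵇ-false h | ∧-zeroʳ (at π (q ∸ 1) <ᵇ at π q) | ∧-zeroʳ (suc q ≤ᵇ length π) =
    ∧-zeroʳ (2 ≤ᵇ q)

  peakᵇ-≤left : ∀ π q → at π q ≤ at π (q ∸ 1) → peakᵇ π q ≡ false
  peakᵇ-≤left π q h rewrite <ᵇ-false h | ∧-zeroʳ (suc q ≤ᵇ length π) = ∧-zeroʳ (2 ≤ᵇ q)

  peakᵇ-beyond : ∀ π q → length π ≤ q → peakᵇ π q ≡ false
  peakᵇ-beyond π q h rewrite ≤ᵇ-false {suc q} {length π} (s≤s h) = ∧-zeroʳ (2 ≤ᵇ q)

  peakᵇ-<2 : ∀ π q → q < 2 → peakᵇ π q ≡ false
  peakᵇ-<2 π zero          _ = refl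
  peakᵇ-<2 π (suc zero)    _ = refl
  peakᵇ-<2 π (suc (suc q)) (s≤s (s≤s ()))

  peakᵇ-range : ∀ π q → peakᵇ π q ≡ true → 2 ≤ q × suc q ≤ length π
  peakᵇ-range π q eq with peakᵇ⇒IsPeak π q eq
  ... | 2≤q , q<len , _ = 2≤q , q<len

  peakᵇ-not-adjacent : ∀ π q → peakᵇ π q ≡ true → peakᵇ π (suc q) ≡ true → ⊥
  peakᵇ-not-adjacent π q e e' with peakᵇ⇒IsPeak π q e | peakᵇ⇒IsPeak π (suc q) e'
  ... | (_ , _ , _ , right<) | (_ , _ , left< , _) = <-asym right< left<

  at-zero : ∀ σ → at σ 0 ≡ 0
  at-zero []      = refl
  at-zero (x ∷ σ) = refl

  at-insertAt-≤ : ∀ i x σ q → i ≤ length σ → q ≤ i → at (insertAt i x σ) q ≡ at σ q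
  at-insertAt-≤ i x σ zero _ _ = trans (at-zero (insertAt i x σ)) (sym (at-zero σ))
  at-insertAt-≤ (suc i) x (y ∷ σ) (suc zero) _ _ = refl
  at-insertAt-≤ (suc i) x (y ∷ σ) (suc (suc q)) (s≤s i≤) (s≤s q≤) = at-insertAt-≤ i x σ (suc q) i≤ q≤

  at-insertAt-here : ∀ i x σ → i ≤ length σ → at (insertAt i x σ) (suc i) ≡ x
  at-insertAt-here zero    x σ       _         = refl
  at-insertAt-here (suc i) x (y ∷ σ) (s≤s i≤) = at-insertAt-here i x σ i≤

  at-insertAt-> : ∀ i x σ q → i ≤ length σ → i < q → at (insertAt i x σ) (suc q) ≡ at σ q
  at-insertAt-> zero    x σ       (suc q)       _         _         = refl
  at-insertAt-> (suc i) x (y ∷ σ) (suc (suc q)) (s≤s i≤) (s≤s i<q) = at-insertAt-> i x σ (suc q) i≤ i<q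

  length-insertAt : ∀ i x σ → i ≤ length σ → length (insertAt i x σ) ≡ suc (length σ)
  length-insertAt zero    x σ       _         = refl
  length-insertAt (suc i) x (y ∷ σ) (s≤s i≤) = cong suc (length-insertAt i x σ i≤)

  -- positions outside σ read as 0
  at-< : ∀ x σ → 0 < x → All (_< x) σ → ∀ q → at σ q < x
  at-< x []      0<x _         q             = 0<x
  at-< x (y ∷ σ) 0<x _         zero          = 0<x
  at-< x (y ∷ σ) 0<x (y<x ∷ _) (suc zero)    = y<x
  at-< x (y ∷ σ) 0<x (_ ∷ σ<x) (suc (suc q)) = at-< x σ 0<x σ<x (suc q)

  module InsertMaximum (i x : ℕ) (σ : List ℕ) (i≤ : i ≤ length σ) (0<x : 0 < x) (σ<x : All (_< x) σ) where

    π : List ℕ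
    π = insertAt i x σ

    length-π : length π ≡ suc (length σ)
    length-π = length-insertAt i x σ i≤

    private
      at<x : ∀ q → at σ q < x
      at<x = at-< x σ 0<x σ<x

    peakᵇ-before : ∀ q → suc q ≤ i → peakᵇ π q ≡ peakᵇ σ q
    peakᵇ-before q q<i
      rewrite at-insertAt-≤ i x σ (q ∸ 1) i≤ (≤-trans (m∸n≤m q 1) (≤-trans (n≤1+n q) q<i))
            | at-insertAt-≤ i x σ q i≤ (≤-trans (n≤1+n q) q<i)
            | at-insertAt-≤ i x σ (suc q) i≤ q<i
            | length-π
            | ≤ᵇ-true {suc q} {suc (length σ)} (≤-trans q<i (≤-trans i≤ (n≤1+n _)))
            | ≤ᵇ-true {suc q} {length σ} (≤-trans q<i i≤) = refl

    peakᵇ-left : peakᵇ π i ≡ false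
    peakᵇ-left = peakᵇ-≤right π i (subst₂ _≤_ (sym (at-insertAt-≤ i x σ i i≤ ≤-refl)) (sym (at-insertAt-here i x σ i≤))
                                     (<⇒≤ (at<x i)))

    peakᵇ-maximum : 1 ≤ i → suc i ≤ length σ → peakᵇ π (suc i) ≡ true
    peakᵇ-maximum 1≤i i<len
      rewrite at-insertAt-here i x σ i≤ | at-insertAt-≤ i x σ i i≤ ≤-refl | at-insertAt-> i x σ (suc i) i≤ ≤-refl | length-π
            | ≤ᵇ-true {2} {suc i} (s≤s 1≤i) | ≤ᵇ-true {suc (suc i)} {suc (length σ)} (s≤s i<len)
            | <ᵇ-true (at<x i) | <ᵇ-true (at<x (suc i)) = refl

    peakᵇ-right : peakᵇ π (suc (suc i)) ≡ false
    peakᵇ-right = peakᵇ-≤left π (suc (suc i))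
      (subst₂ _≤_ (sym (at-insertAt-> i x σ (suc i) i≤ ≤-refl)) (sym (at-insertAt-here i x σ i≤)) (<⇒≤ (at<x (suc i))))

    peakᵇ-after : ∀ q → suc i < q → peakᵇ π (suc q) ≡ peakᵇ σ q
    peakᵇ-after (suc q) (s≤s i<q)
      rewrite at-insertAt-> i x σ q i≤ i<q
            | at-insertAt-> i x σ (suc q) i≤ (≤-trans i<q (n≤1+n _))
            | at-insertAt-> i x σ (suc (suc q)) i≤ (≤-trans i<q (≤-trans (n≤1+n _) (n≤1+n _)))
            | length-π | ≤ᵇ-true {2} {suc (suc q)} (s≤s (s≤s z≤n)) | ≤ᵇ-true {2} {suc q} (s≤s (≤-trans (s≤s z≤n) i<q)) = refl


module PeakSets where

  open import Data.Nat using (ℕ; suc; _≤_; _<_; z≤n; s≤s; _≡ᵇ_; pred)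
  open import Data.Nat.Properties using (≤-trans; ≤-refl; n≤1+n; ≤-pred; <-irrefl; <⇒≤; <⇒≢; <-cmp; ≡ᵇ⇒≡; ≡⇒≡ᵇ)
  open import Data.Bool using (Bool; true; false; _∧_; _∨_)
  open import Data.Bool.Properties using (∨-identityʳ; ∨-zeroʳ; ∨-assoc; ∧-zeroʳ; ∧-identityʳ; T-≡; ¬-not)
  open import Function.Bundles using (Equivalence)
  open import Data.List using (List; []; _∷_; _++_; length; map)
  open import Data.List.Membership.Propositional using (_∈_)
  open import Data.List.Relation.Unary.Any using (here; there)
  open import Data.List.Relation.Unary.All using (All; []; _∷_)
  import Data.List.Relation.Unary.All as All
  open import Data.Product using (_×_; _,_)
  open import Relation.Binary.PropositionalEquality using (_≡_; _≢_; refl; sym; trans; subst)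
  open import Relation.Binary.Definitions using (tri<; tri≈; tri>)
  open import Relation.Nullary using (contradiction)
  open import Function using (_∘_)
  open PeakIndicator

  memᵇ : ℕ → List ℕ → Bool
  memᵇ q []       = false
  memᵇ q (a ∷ as) = (q ≡ᵇ a) ∨ memᵇ q as

  HasPeaks : List ℕ → List ℕ → Set
  HasPeaks σ U = ∀ q → peakᵇ σ q ≡ memᵇ q U

  ≡ᵇ-refl : ∀ q → (q ≡ᵇ q) ≡ true
  ≡ᵇ-refl q = Equivalence.to T-≡ (≡⇒≡ᵇ q q refl)

  ≡ᵇ-sound : ∀ {q a} → (q ≡ᵇ a) ≡ true → q ≡ a
  ≡ᵇ-sound {q} {a} eq = ≡ᵇ⇒≡ q a (Equivalence.from T-≡ eq)

  ≡ᵇ-false : ∀ {q a} → q ≢ a → (q ≡ᵇ a) ≡ false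
  ≡ᵇ-false q≢a = ¬-not (q≢a ∘ ≡ᵇ-sound)

  memᵇ⇒∈ : ∀ q xs → memᵇ q xs ≡ true → q ∈ xs
  memᵇ⇒∈ q (a ∷ xs) eq with q ≡ᵇ a in q≡a
  ... | true  = here (≡ᵇ-sound q≡a)
  ... | false = there (memᵇ⇒∈ q xs eq)

  ∈⇒memᵇ : ∀ q xs → q ∈ xs → memᵇ q xs ≡ true
  ∈⇒memᵇ q (a ∷ xs) (here refl) rewrite ≡ᵇ-refl q = refl
  ∈⇒memᵇ q (a ∷ xs) (there q∈)  rewrite ∈⇒memᵇ q xs q∈ = ∨-zeroʳ (q ≡ᵇ a)

  memᵇ-++ : ∀ q xs ys → memᵇ q (xs ++ ys) ≡ (memᵇ q xs ∨ memᵇ q ys)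
  memᵇ-++ q []       ys = refl
  memᵇ-++ q (a ∷ xs) ys rewrite memᵇ-++ q xs ys = sym (∨-assoc (q ≡ᵇ a) (memᵇ q xs) (memᵇ q ys))

  memᵇ-false : ∀ q xs → All (q ≢_) xs → memᵇ q xs ≡ false
  memᵇ-false q []       _          = refl
  memᵇ-false q (a ∷ xs) (q≢a ∷ h) rewrite ≡ᵇ-false q≢a = memᵇ-false q xs h

  memᵇ-map-pred : ∀ q ys → All (1 ≤_) ys → memᵇ q (map pred ys) ≡ memᵇ (suc q) ys
  memᵇ-map-pred q []           _           = refl
  memᵇ-map-pred q (suc y ∷ ys) (s≤s _ ∷ h) rewrite memᵇ-map-pred q ys h = refl

  optional : Bool → ℕ → List ℕ
  optional true  a = a ∷ []
  optional false a = []

  memᵇ-optional : ∀ q b a → memᵇ q (optional b a) ≡ (b ∧ (q ≡ᵇ a))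
  memᵇ-optional q true  a = ∨-identityʳ (q ≡ᵇ a)
  memᵇ-optional q false a = refl

  -- whole = xs ++ (i + 1) ∷ ys with all other elements at distance ≥ 2 from i + 1; child b₁ b₂
  -- deletes i + 1, shifts ys down by one and puts back i if b₁ and i + 1 if b₂.
  module Split (xs : List ℕ) (i : ℕ) (ys : List ℕ)
               (xs<i : All (λ a → suc (suc a) ≤ suc i) xs) (ys>i+2 : All (λ b → suc (suc (suc i)) ≤ b) ys) where

    whole : List ℕ
    whole = xs ++ suc i ∷ ys

    child : Bool → Bool → List ℕ
    child b₁ b₂ = xs ++ (optional b₁ i ++ (optional b₂ (suc i) ++ map pred ys))

    private
      memᵇ-whole : ∀ q → memᵇ q whole ≡ (memᵇ q xs ∨ ((q ≡ᵇ suc i) ∨ memᵇ q ys))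
      memᵇ-whole q = memᵇ-++ q xs (suc i ∷ ys)

      memᵇ-child : ∀ q b₁ b₂ → memᵇ q (child b₁ b₂) ≡
                   (memᵇ q xs ∨ ((b₁ ∧ (q ≡ᵇ i)) ∨ ((b₂ ∧ (q ≡ᵇ suc i)) ∨ memᵇ (suc q) ys)))
      memᵇ-child q b₁ b₂
        rewrite memᵇ-++ q xs (optional b₁ i ++ (optional b₂ (suc i) ++ map pred ys))
              | memᵇ-++ q (optional b₁ i) (optional b₂ (suc i) ++ map pred ys)
              | memᵇ-++ q (optional b₂ (suc i)) (map pred ys)
              | memᵇ-optional q b₁ i | memᵇ-optional q b₂ (suc i)
              | memᵇ-map-pred q ys (All.map (≤-trans (s≤s z≤n)) ys>i+2) = refl

      memᵇ-xs-≥ : ∀ q → i ≤ q → memᵇ q xs ≡ false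
      memᵇ-xs-≥ q i≤q = memᵇ-false q xs (All.map (λ h q≡a → <-irrefl (sym q≡a) (≤-trans (≤-pred h) i≤q)) xs<i)

      memᵇ-ys-≤ : ∀ q → q ≤ suc (suc i) → memᵇ q ys ≡ false
      memᵇ-ys-≤ q q≤ = memᵇ-false q ys (All.map (λ h q≡b → <-irrefl q≡b (≤-trans (s≤s q≤) h)) ys>i+2)

    memᵇ-child-below : ∀ q b₁ b₂ → q < i → memᵇ q (child b₁ b₂) ≡ memᵇ q xs
    memᵇ-child-below q b₁ b₂ q<i
      rewrite memᵇ-child q b₁ b₂ | ≡ᵇ-false (<⇒≢ q<i) | ≡ᵇ-false (<⇒≢ (≤-trans q<i (n≤1+n _)))
            | memᵇ-ys-≤ (suc q) (≤-trans q<i (≤-trans (n≤1+n _) (n≤1+n _)))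
            | ∧-zeroʳ b₁ | ∧-zeroʳ b₂ = ∨-identityʳ (memᵇ q xs)

    memᵇ-whole-below : ∀ q → q < i → memᵇ q whole ≡ memᵇ q xs
    memᵇ-whole-below q q<i
      rewrite memᵇ-whole q | ≡ᵇ-false (<⇒≢ (≤-trans q<i (n≤1+n _)))
            | memᵇ-ys-≤ q (≤-trans (<⇒≤ q<i) (≤-trans (n≤1+n _) (n≤1+n _))) = ∨-identityʳ (memᵇ q xs)

    memᵇ-child-i : ∀ b₁ b₂ → memᵇ i (child b₁ b₂) ≡ b₁
    memᵇ-child-i b₁ b₂
      rewrite memᵇ-child i b₁ b₂ | memᵇ-xs-≥ i ≤-refl | ≡ᵇ-refl i | ≡ᵇ-false (<⇒≢ (≤-refl {suc i}))
            | memᵇ-ys-≤ (suc i) (n≤1+n _) | ∧-zeroʳ b₂ | ∧-identityʳ b₁ = ∨-identityʳ b₁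

    memᵇ-whole-i : memᵇ i whole ≡ false
    memᵇ-whole-i rewrite memᵇ-whole i | memᵇ-xs-≥ i ≤-refl | ≡ᵇ-false (<⇒≢ (≤-refl {suc i}))
                       | memᵇ-ys-≤ i (≤-trans (n≤1+n _) (n≤1+n _)) = refl

    memᵇ-child-p : ∀ b₁ b₂ → memᵇ (suc i) (child b₁ b₂) ≡ b₂
    memᵇ-child-p b₁ b₂
      rewrite memᵇ-child (suc i) b₁ b₂ | memᵇ-xs-≥ (suc i) (n≤1+n _) | ≡ᵇ-refl (suc i)
            | ≡ᵇ-false {suc i} {i} (λ e → <-irrefl (sym e) ≤-refl)
            | memᵇ-ys-≤ (suc (suc i)) ≤-refl | ∧-zeroʳ b₁ | ∧-identityʳ b₂ = ∨-identityʳ b₂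

    memᵇ-whole-p : memᵇ (suc i) whole ≡ true
    memᵇ-whole-p rewrite memᵇ-whole (suc i) | ≡ᵇ-refl (suc i) = ∨-zeroʳ (memᵇ (suc i) xs)

    memᵇ-whole-p+1 : memᵇ (suc (suc i)) whole ≡ false
    memᵇ-whole-p+1 rewrite memᵇ-whole (suc (suc i)) | memᵇ-xs-≥ (suc (suc i)) (≤-trans (n≤1+n _) (n≤1+n _))
                         | ≡ᵇ-false {suc (suc i)} {suc i} (λ e → <-irrefl (sym e) ≤-refl)
                         | memᵇ-ys-≤ (suc (suc i)) ≤-refl = refl

    memᵇ-child-above : ∀ q b₁ b₂ → suc i < q → memᵇ q (child b₁ b₂) ≡ memᵇ (suc q) whole
    memᵇ-child-above q b₁ b₂ i+1<q
      rewrite memᵇ-child q b₁ b₂ | memᵇ-whole (suc q)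
            | memᵇ-xs-≥ q (≤-trans (n≤1+n i) (≤-trans (n≤1+n _) i+1<q))
            | memᵇ-xs-≥ (suc q) (≤-trans (n≤1+n i) (≤-trans (n≤1+n _) (≤-trans i+1<q (n≤1+n _))))
            | ≡ᵇ-false {q} {i} (λ e → <-irrefl (sym e) (≤-trans (n≤1+n _) i+1<q))
            | ≡ᵇ-false {q} {suc i} (λ e → <-irrefl (sym e) i+1<q)
            | ∧-zeroʳ b₁ | ∧-zeroʳ b₂ = refl

  -- Inserting N + 1 at position i of σ ∈ 𝔖_N creates the peak i + 1 of π, removes σ's peaks at
  -- i and i + 1, and moves every later peak one place to the right.
  module InsertAtPeak (N : ℕ) (σ : List ℕ) (length-σ : length σ ≡ N) (σ<N+1 : All (_< suc N) σ)
                      (xs : List ℕ) (i : ℕ) (ys : List ℕ)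
                      (xs<i : All (λ a → suc (suc a) ≤ suc i) xs) (ys>i+2 : All (λ b → suc (suc (suc i)) ≤ b) ys)
                      (1≤i : 1 ≤ i) (i<N : suc i ≤ N) where

    open Split xs i ys xs<i ys>i+2 public

    private
      i≤ : i ≤ length σ
      i≤ = subst (i ≤_) (sym length-σ) (≤-trans (n≤1+n i) i<N)

    open InsertMaximum i (suc N) σ i≤ (s≤s z≤n) σ<N+1 public

    HasPeaks-insert⁺ : ∀ b₁ b₂ → HasPeaks σ (child b₁ b₂) → HasPeaks π whole
    HasPeaks-insert⁺ b₁ b₂ h q with <-cmp q i
    ... | tri< q<i _ _ = trans (peakᵇ-before q q<i) (trans (h q) (trans (memᵇ-child-below q b₁ b₂ q<i) (sym (memᵇ-whole-below q q<i))))
    ... | tri≈ _ refl _ = trans peakᵇ-left (sym memᵇ-whole-i)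
    HasPeaks-insert⁺ b₁ b₂ h (suc q) | tri> _ _ (s≤s i≤q) with <-cmp q i
    ... | tri< q<i _ _ = contradiction (≤-trans q<i i≤q) (<-irrefl refl)
    ... | tri≈ _ refl _ = trans (peakᵇ-maximum 1≤i (subst (suc i ≤_) (sym length-σ) i<N)) (sym memᵇ-whole-p)
    HasPeaks-insert⁺ b₁ b₂ h (suc (suc q)) | tri> _ _ _ | tri> _ _ (s≤s i≤q) with <-cmp q i
    ... | tri< q<i _ _ = contradiction (≤-trans q<i i≤q) (<-irrefl refl)
    ... | tri≈ _ refl _ = trans peakᵇ-right (sym memᵇ-whole-p+1)
    ... | tri> _ _ i<q = trans (peakᵇ-after (suc q) (s≤s i<q)) (trans (h (suc q)) (memᵇ-child-above (suc q) b₁ b₂ (s≤s i<q)))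

    β₁ β₂ : Bool
    β₁ = peakᵇ σ i
    β₂ = peakᵇ σ (suc i)

    HasPeaks-insert⁻ : HasPeaks π whole → HasPeaks σ (child β₁ β₂)
    HasPeaks-insert⁻ h q with <-cmp q i
    ... | tri< q<i _ _ = trans (sym (peakᵇ-before q q<i))
                           (trans (h q) (trans (memᵇ-whole-below q q<i) (sym (memᵇ-child-below q β₁ β₂ q<i))))
    ... | tri≈ _ refl _ = sym (memᵇ-child-i β₁ β₂)
    HasPeaks-insert⁻ h (suc q) | tri> _ _ (s≤s i≤q) with <-cmp q i
    ... | tri< q<i _ _ = contradiction (≤-trans q<i i≤q) (<-irrefl refl)
    ... | tri≈ _ refl _ = sym (memᵇ-child-p β₁ β₂)
    ... | tri> _ _ i<q = trans (sym (peakᵇ-after (suc q) (s≤s i<q)))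
                           (trans (h (suc (suc q))) (sym (memᵇ-child-above (suc q) β₁ β₂ (s≤s i<q))))

    HasPeaks-child-flags : ∀ b₁ b₂ → HasPeaks σ (child b₁ b₂) → b₁ ≡ β₁ × b₂ ≡ β₂
    HasPeaks-child-flags b₁ b₂ h = trans (sym (memᵇ-child-i b₁ b₂)) (sym (h i)) , trans (sym (memᵇ-child-p b₁ b₂)) (sym (h (suc i)))


module PeakCounting where

  open import Data.Nat using (ℕ; zero; suc; _+_; _≤_; _<_; _<ᵇ_)
  open import Data.Nat.Properties using (≤-trans; ≤-pred; <-irrefl; m≤n⇒m<n∨m≡n; <-≤-connex)
  open import Data.Bool using (Bool; true; false; _∧_; if_then_else_)
  open import Data.Bool.Properties using (T?; T-≡; ⇔→≡; ¬-not) renaming (_≟_ to _≟ᵇ_)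
  open import Data.List using (List; []; _∷_; length; filter)
  open import Data.List.Membership.Propositional using (_∈_)
  open import Data.List.Membership.Propositional.Properties using (∈-filter⁺; ∈-filter⁻)
  open import Data.List.Membership.Propositional.Properties.WithK using (unique∧set⇒bag)
  open import Data.List.Relation.Binary.BagAndSetEquality using (∼bag⇒↭)
  open import Data.List.Relation.Unary.Any using (here; there)
  open import Data.List.Relation.Unary.Unique.Propositional using (Unique)
  import Data.List.Relation.Unary.Unique.Propositional.Properties as Unique
  open import Data.Product using (Σ; _×_; _,_; proj₂)
  open import Data.Sum using (inj₁; inj₂)
  open import Function.Bundles using (mk⇔; Equivalence)
  open import Relation.Binary.PropositionalEquality using (_≡_; refl; sym; trans; cong; subst)
  open import Relation.Nullary using (¬_; contradiction)
  open import Function using (_∘_)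
  open ListSum
  open Permutations using (permutations)
  open PeakIndicator
  open PeakSets

  sameᵇ : Bool → Bool → Bool
  sameᵇ true  true  = true
  sameᵇ false false = true
  sameᵇ _     _     = false

  sameᵇ-sound : ∀ a b → sameᵇ a b ≡ true → a ≡ b
  sameᵇ-sound true  true  _ = refl
  sameᵇ-sound false false _ = refl

  sameᵇ-refl : ∀ a → sameᵇ a a ≡ true
  sameᵇ-refl true  = refl
  sameᵇ-refl false = refl

  agreeBelowᵇ : List ℕ → List ℕ → ℕ → Bool
  agreeBelowᵇ σ U zero    = true
  agreeBelowᵇ σ U (suc n) = sameᵇ (peakᵇ σ n) (memᵇ n U) ∧ agreeBelowᵇ σ U n

  allBelowᵇ : ℕ → List ℕ → Bool
  allBelowᵇ n []      = true
  allBelowᵇ n (a ∷ U) = (a <ᵇ n) ∧ allBelowᵇ n U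

  -- peaks only occur at positions < length σ, so finitely many checks decide HasPeaks σ U
  hasPeaksᵇ : List ℕ → List ℕ → Bool
  hasPeaksᵇ σ U = agreeBelowᵇ σ U (length σ) ∧ allBelowᵇ (length σ) U

  agreeBelowᵇ-sound : ∀ σ U n → agreeBelowᵇ σ U n ≡ true → ∀ q → q < n → peakᵇ σ q ≡ memᵇ q U
  agreeBelowᵇ-sound σ U (suc n) eq q q<n with ∧-true⁻ {sameᵇ (peakᵇ σ n) (memᵇ n U)} eq
  ... | same , rest with m≤n⇒m<n∨m≡n (≤-pred q<n)
  ... | inj₁ q<n' = agreeBelowᵇ-sound σ U n rest q q<n'
  ... | inj₂ refl = sameᵇ-sound _ _ same

  agreeBelowᵇ-complete : ∀ σ U n → HasPeaks σ U → agreeBelowᵇ σ U n ≡ true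
  agreeBelowᵇ-complete σ U zero    h = refl
  agreeBelowᵇ-complete σ U (suc n) h rewrite h n | sameᵇ-refl (memᵇ n U) = agreeBelowᵇ-complete σ U n h

  allBelowᵇ-sound : ∀ n U → allBelowᵇ n U ≡ true → ∀ q → n ≤ q → memᵇ q U ≡ false
  allBelowᵇ-sound n []      eq q n≤q = refl
  allBelowᵇ-sound n (a ∷ U) eq q n≤q with ∧-true⁻ {a <ᵇ n} eq
  ... | a<n , rest rewrite ≡ᵇ-false {q} {a} (λ q≡a → <-irrefl refl (≤-trans (<ᵇ-sound a<n) (subst (n ≤_) q≡a n≤q)))
    = allBelowᵇ-sound n U rest q n≤q

  allBelowᵇ-complete : ∀ σ U → HasPeaks σ U → ∀ V → (∀ {a} → a ∈ V → a ∈ U) → allBelowᵇ (length σ) V ≡ true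
  allBelowᵇ-complete σ U h []      V⊆U = refl
  allBelowᵇ-complete σ U h (a ∷ V) V⊆U
    rewrite <ᵇ-true (proj₂ (peakᵇ-range σ a (trans (h a) (∈⇒memᵇ a U (V⊆U (here refl)))))) =
    allBelowᵇ-complete σ U h V (V⊆U ∘ there)

  hasPeaksᵇ-sound : ∀ σ U → hasPeaksᵇ σ U ≡ true → HasPeaks σ U
  hasPeaksᵇ-sound σ U eq q with ∧-true⁻ {agreeBelowᵇ σ U (length σ)} eq | <-≤-connex q (length σ)
  ... | agree , _     | inj₁ q<len = agreeBelowᵇ-sound σ U (length σ) agree q q<len
  ... | _     , below | inj₂ len≤q = trans (peakᵇ-beyond σ q len≤q) (sym (allBelowᵇ-sound (length σ) U below q len≤q))

  hasPeaksᵇ-complete : ∀ σ U → HasPeaks σ U → hasPeaksᵇ σ U ≡ true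
  hasPeaksᵇ-complete σ U h rewrite agreeBelowᵇ-complete σ U (length σ) h = allBelowᵇ-complete σ U h U (λ a∈ → a∈)

  hasPeaksᵇ-false : ∀ σ U → ¬ HasPeaks σ U → hasPeaksᵇ σ U ≡ false
  hasPeaksᵇ-false σ U ¬h = ¬-not (¬h ∘ hasPeaksᵇ-sound σ U)

  hasPeaksᵇ-cong : ∀ σ U σ' U' → (HasPeaks σ U → HasPeaks σ' U') → (HasPeaks σ' U' → HasPeaks σ U) →
                   hasPeaksᵇ σ U ≡ hasPeaksᵇ σ' U'
  hasPeaksᵇ-cong σ U σ' U' to from = ⇔→≡ {z = true} (mk⇔
    (λ eq → hasPeaksᵇ-complete σ' U' (to (hasPeaksᵇ-sound σ U eq)))
    (λ eq → hasPeaksᵇ-complete σ U (from (hasPeaksᵇ-sound σ' U' eq))))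

  indicator : Bool → ℕ
  indicator true  = 1
  indicator false = 0

  peakCount : List ℕ → ℕ → ℕ
  peakCount U N = ∑ (permutations N) (λ σ → indicator (hasPeaksᵇ σ U))

  peakCount-zero : ∀ U N → (∀ σ → σ ∈ permutations N → ¬ HasPeaks σ U) → peakCount U N ≡ 0
  peakCount-zero U N none = ∑-zero (permutations N) (λ σ σ∈ → cong indicator (hasPeaksᵇ-false σ U (none σ σ∈)))

  withPeaks : List ℕ → ℕ → List (List ℕ)
  withPeaks U N = filter (λ σ → hasPeaksᵇ σ U ≟ᵇ true) (permutations N)

  length-withPeaks : ∀ U N → length (withPeaks U N) ≡ peakCount U N
  length-withPeaks U N = go (permutations N)
    where
    go : ∀ σs → length (filter (λ σ → hasPeaksᵇ σ U ≟ᵇ true) σs) ≡ ∑ σs (λ σ → indicator (hasPeaksᵇ σ U))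
    go []       = refl
    go (σ ∷ σs) with hasPeaksᵇ σ U
    ... | true  = cong suc (go σs)
    ... | false = go σs

  peakCount≢0⇒∃ : ∀ U N → ¬ peakCount U N ≡ 0 → Σ (List ℕ) λ σ → σ ∈ permutations N × HasPeaks σ U
  peakCount≢0⇒∃ U N count≢0 = go (permutations N) count≢0
    where
    go : ∀ σs → ¬ ∑ σs (λ σ → indicator (hasPeaksᵇ σ U)) ≡ 0 → Σ (List ℕ) λ σ → σ ∈ σs × HasPeaks σ U
    go []       ≢0 = contradiction refl ≢0
    go (σ ∷ σs) ≢0 with hasPeaksᵇ σ U in eq
    ... | true  = σ , here refl , hasPeaksᵇ-sound σ U eq
    ... | false with go σs ≢0
    ... | τ , τ∈ , h = τ , there τ∈ , h

  ∑-restrict : ∀ U R (f : ℕ → ℕ) → Unique U → Unique R → (∀ {a} → a ∈ U → a ∈ R) →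
               ∑ R (λ r → if memᵇ r U then f r else 0) ≡ ∑ U f
  ∑-restrict U R f uU uR U⊆R = trans (∑-filter R) (∑-↭ f (∼bag⇒↭ (unique∧set⇒bag (Unique.filter⁺ inT? uR) uU
    (mk⇔ (λ x∈ → memᵇ⇒∈ _ U (Equivalence.to T-≡ (proj₂ (∈-filter⁻ inT? {xs = R} x∈))))
         (λ x∈ → ∈-filter⁺ inT? (U⊆R x∈) (Equivalence.from T-≡ (∈⇒memᵇ _ U x∈)))))))
    where
    inT? = λ r → T? (memᵇ r U)
    ∑-filter : ∀ R → ∑ R (λ r → if memᵇ r U then f r else 0) ≡ ∑ (filter inT? R) f
    ∑-filter []      = refl
    ∑-filter (r ∷ R) with memᵇ r U
    ... | true  = cong (f r +_) (∑-filter R)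
    ... | false = ∑-filter R


module Splittings where

  open import Data.Nat using (ℕ; zero; suc; _+_; _≤_; pred; _≤ᵇ_)
  open import Data.Nat.Properties using (≤-trans; n≤1+n; <-irrefl; +-identityʳ; 0≢1+n)
  open import Data.Bool using (Bool; true; false; _∧_)
  open import Data.List using (List; []; _∷_; _++_; map)
  open import Data.List.Properties using (map-∘)
  open import Data.List.Membership.Propositional using (_∈_)
  open import Data.List.Membership.Propositional.Properties using (∈-map⁻)
  open import Data.List.Relation.Unary.Any using (here; there)
  open import Data.List.Relation.Unary.All using (All; []; _∷_)
  import Data.List.Relation.Unary.All as All
  open import Data.List.Relation.Unary.Unique.Propositional using (Unique)
  open import Data.List.Relation.Unary.AllPairs using (_∷_; [])
  open import Data.Product using (_×_; _,_)
  open import Relation.Binary.PropositionalEquality using (_≡_; _≢_; refl; sym; trans; cong)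
  open import Relation.Nullary using (¬_; contradiction)
  open PeakIndicator using (∧-true⁻; ≤ᵇ-sound)
  open PeakSets using (optional)

  Splitting : Set
  Splitting = List ℕ × ℕ × List ℕ

  pivot : Splitting → ℕ
  pivot (_ , p , _) = p

  extendˡ : ℕ → Splitting → Splitting
  extendˡ a (xs , p , ys) = a ∷ xs , p , ys

  splittings : List ℕ → List Splitting
  splittings []       = []
  splittings (a ∷ as) = ([] , a , as) ∷ map (extendˡ a) (splittings as)

  map-pivot-splittings : ∀ T → map pivot (splittings T) ≡ T
  map-pivot-splittings []      = refl
  map-pivot-splittings (a ∷ T) = cong (a ∷_) (trans (sym (map-∘ (splittings T))) (map-pivot-splittings T))

  childSet : Splitting → Bool → Bool → List ℕ
  childSet (xs , p , ys) b₁ b₂ = xs ++ (optional b₁ (pred p) ++ (optional b₂ p ++ map pred ys))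

  deleted lowered raised : Splitting → List ℕ
  deleted s = childSet s false false
  lowered s = childSet s true  false
  raised  s = childSet s false true

  separatedᵇ : ℕ → List ℕ → Bool
  separatedᵇ lo []       = true
  separatedᵇ lo (a ∷ as) = (lo ≤ᵇ a) ∧ separatedᵇ (suc (suc a)) as

  -- the sorted sets that can be peak sets
  Separated : List ℕ → Set
  Separated U = separatedᵇ 2 U ≡ true

  separated-≥ : ∀ lo U → separatedᵇ lo U ≡ true → All (lo ≤_) U
  separated-≥ lo []      _  = []
  separated-≥ lo (a ∷ U) eq with ∧-true⁻ {lo ≤ᵇ a} eq
  ... | lo≤a , rest = ≤ᵇ-sound lo≤a
                      ∷ All.map (≤-trans (≤-trans (≤ᵇ-sound lo≤a) (≤-trans (n≤1+n _) (n≤1+n _)))) (separated-≥ _ U rest)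

  separated-unique : ∀ lo U → separatedᵇ lo U ≡ true → Unique U
  separated-unique lo []      _  = []
  separated-unique lo (a ∷ U) eq with ∧-true⁻ {lo ≤ᵇ a} eq
  ... | _ , rest = All.map (λ a+2≤b a≡b → <-irrefl a≡b (≤-trans (n≤1+n _) a+2≤b)) (separated-≥ _ U rest)
                   ∷ separated-unique _ U rest

  splitting-shape : ∀ lo T {xs p ys} → separatedᵇ lo T ≡ true → (xs , p , ys) ∈ splittings T →
                    T ≡ xs ++ p ∷ ys × All (λ a → suc (suc a) ≤ p) xs × All (λ b → suc (suc p) ≤ b) ys × lo ≤ p
  splitting-shape lo (a ∷ T) eq (here refl) with ∧-true⁻ {lo ≤ᵇ a} eq
  ... | lo≤a , rest = refl , [] , separated-≥ _ T rest , ≤ᵇ-sound lo≤a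
  splitting-shape lo (a ∷ T) eq (there s∈) with ∧-true⁻ {lo ≤ᵇ a} eq | ∈-map⁻ (extendˡ a) {xs = splittings T} s∈
  ... | lo≤a , rest | (xs , p , ys) , s∈' , refl with splitting-shape (suc (suc a)) T rest s∈'
  ... | T≡ , xs<p , ys>p , a+2≤p =
    cong (a ∷_) T≡ , a+2≤p ∷ xs<p , ys>p , ≤-trans (≤ᵇ-sound lo≤a) (≤-trans (n≤1+n _) (≤-trans (n≤1+n _) a+2≤p))

  ∑𝔹² : (Bool → Bool → ℕ) → ℕ
  ∑𝔹² f = f false false + (f true false + (f false true + f true true))

  ∑𝔹²-off-support : ∀ (f : Bool → Bool → ℕ) β₁ β₂ → (∀ b₁ b₂ → f b₁ b₂ ≢ 0 → b₁ ≡ β₁ × b₂ ≡ β₂) → ∀ b₁ b₂ → ¬ (b₁ ≡ β₁ × b₂ ≡ β₂) → f b₁ b₂ ≡ 0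
  ∑𝔹²-off-support f β₁ β₂ support b₁ b₂ off with f b₁ b₂ in eq
  ... | zero  = refl
  ... | suc _ = contradiction (support b₁ b₂ (λ f≡0 → 0≢1+n (trans (sym f≡0) eq))) off

  ∑𝔹²-single : ∀ (f : Bool → Bool → ℕ) β₁ β₂ → (∀ b₁ b₂ → f b₁ b₂ ≢ 0 → b₁ ≡ β₁ × b₂ ≡ β₂) → ∑𝔹² f ≡ f β₁ β₂
  ∑𝔹²-single f false false s rewrite ∑𝔹²-off-support f _ _ s true false (λ { (() , _) })
    | ∑𝔹²-off-support f _ _ s false true (λ { (_ , ()) }) | ∑𝔹²-off-support f _ _ s true true (λ { (() , _) }) = +-identityʳ _
  ∑𝔹²-single f true false s rewrite ∑𝔹²-off-support f _ _ s false false (λ { (() , _) })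
    | ∑𝔹²-off-support f _ _ s false true (λ { (() , _) }) | ∑𝔹²-off-support f _ _ s true true (λ { (_ , ()) }) = +-identityʳ _
  ∑𝔹²-single f false true s rewrite ∑𝔹²-off-support f _ _ s false false (λ { (_ , ()) })
    | ∑𝔹²-off-support f _ _ s true false (λ { (() , _) }) | ∑𝔹²-off-support f _ _ s true true (λ { (() , _) }) = +-identityʳ _
  ∑𝔹²-single f true true s rewrite ∑𝔹²-off-support f _ _ s false false (λ { (() , _) })
    | ∑𝔹²-off-support f _ _ s true false (λ { (_ , ()) }) | ∑𝔹²-off-support f _ _ s false true (λ { (() , _) }) = refl

module InsertionRecursion where

  open import Data.Nat using (ℕ; zero; suc; _+_; _*_; _≤_; _<_; z≤n; s≤s; pred)
  open import Data.Nat.Properties using (≤-trans; ≤-refl; n≤1+n; <⇒≤; <-irrefl; <-cmp; +-comm; +-identityʳ; suc-injective)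
  open import Data.Nat.Solver using (module +-*-Solver)
  open import Data.Bool using (Bool; true; false; if_then_else_)
  open import Data.List using (List; []; _∷_; _++_; map; length; upTo; applyUpTo)
  open import Data.List.Properties using (applyUpTo-∷ʳ)
  open import Data.List.Membership.Propositional using (_∈_)
  open import Data.List.Membership.Propositional.Properties using (∈-map⁺; ∈-applyUpTo⁺; ∈-applyUpTo⁻; ∈-++⁺ʳ)
  open import Data.List.Relation.Unary.Any using (here)
  open import Data.List.Relation.Unary.All using (All)
  import Data.List.Relation.Unary.All as All
  open import Data.List.Relation.Unary.Unique.Propositional using (Unique)
  import Data.List.Relation.Unary.Unique.Propositional.Properties as Unique
  open import Data.Product using (_×_; _,_)
  open import Relation.Binary.PropositionalEquality using (_≡_; _≢_; refl; sym; trans; cong; cong₂; subst; module ≡-Reasoning)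
  open import Relation.Binary.Definitions using (tri<; tri≈; tri>)
  open import Relation.Nullary using (¬_; contradiction)
  open ListSum
  open Permutations
  open PeakIndicator
  open PeakSets
  open PeakCounting
  open Splittings

  module InsertAtEnds (N : ℕ) (σ : List ℕ) (length-σ : length σ ≡ N) (σ<N+1 : All (_< suc N) σ) where

    private
      module Front = InsertMaximum 0 (suc N) σ z≤n (s≤s z≤n) σ<N+1
      module Back  = InsertMaximum N (suc N) σ (subst (N ≤_) (sym length-σ) ≤-refl) (s≤s z≤n) σ<N+1

    HasPeaks-front⁻ : ∀ T → All (2 ≤_) T → HasPeaks (suc N ∷ σ) T → HasPeaks σ (map pred T)
    HasPeaks-front⁻ T T≥2 h zero = trans (peakᵇ-<2 σ 0 (s≤s z≤n))
      (sym (trans (memᵇ-map-pred 0 T (All.map (≤-trans (s≤s z≤n)) T≥2)) (memᵇ-false 1 T (All.map (λ 2≤a 1≡a → <-irrefl 1≡a 2≤a) T≥2))))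
    HasPeaks-front⁻ T T≥2 h (suc zero) = trans (peakᵇ-<2 σ 1 (s≤s (s≤s z≤n)))
      (sym (trans (memᵇ-map-pred 1 T (All.map (≤-trans (s≤s z≤n)) T≥2)) (trans (sym (h 2)) Front.peakᵇ-right)))
    HasPeaks-front⁻ T T≥2 h (suc (suc q)) = trans (sym (Front.peakᵇ-after (suc (suc q)) (s≤s (s≤s z≤n))))
      (trans (h (suc (suc (suc q)))) (sym (memᵇ-map-pred (suc (suc q)) T (All.map (≤-trans (s≤s z≤n)) T≥2))))

    HasPeaks-front⁺ : ∀ T → All (2 ≤_) T → HasPeaks σ (map pred T) → HasPeaks (suc N ∷ σ) T
    HasPeaks-front⁺ T T≥2 h zero = sym (memᵇ-false 0 T (All.map (λ 2≤a 0≡a → <-irrefl 0≡a (≤-trans (s≤s z≤n) 2≤a)) T≥2))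
    HasPeaks-front⁺ T T≥2 h (suc zero) = sym (memᵇ-false 1 T (All.map (λ 2≤a 1≡a → <-irrefl 1≡a 2≤a) T≥2))
    HasPeaks-front⁺ T T≥2 h (suc (suc zero)) = trans Front.peakᵇ-right
      (trans (sym (peakᵇ-<2 σ 1 (s≤s (s≤s z≤n)))) (trans (h 1) (memᵇ-map-pred 1 T (All.map (≤-trans (s≤s z≤n)) T≥2))))
    HasPeaks-front⁺ T T≥2 h (suc (suc (suc q))) = trans (Front.peakᵇ-after (suc (suc q)) (s≤s (s≤s z≤n)))
      (trans (h (suc (suc q))) (memᵇ-map-pred (suc (suc q)) T (All.map (≤-trans (s≤s z≤n)) T≥2)))

    peakᵇ-insert-back : ∀ q → peakᵇ (insertAt N (suc N) σ) q ≡ peakᵇ σ q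
    peakᵇ-insert-back q with <-cmp q N
    ... | tri< q<N _ _ = Back.peakᵇ-before q q<N
    ... | tri≈ _ refl _ = trans Back.peakᵇ-left (sym (peakᵇ-beyond σ q (subst (_≤ q) (sym length-σ) ≤-refl)))
    ... | tri> _ _ N<q = trans (peakᵇ-beyond Back.π q (subst (_≤ q) (sym Back.length-π) (subst (λ n → suc n ≤ q) (sym length-σ) N<q)))
                               (sym (peakᵇ-beyond σ q (subst (_≤ q) (sym length-σ) (<⇒≤ N<q))))

  -- Sorting the insertions of N + 1 into a fixed σ ∈ 𝔖_N by where the new peak lands.
  module InsertionsOf (N' : ℕ) {σ : List ℕ} (σ∈ : σ ∈ permutations (suc N')) (T : List ℕ) (sepT : Separated T)
                      (T≤ : All (_≤ suc N') T) where

    N : ℕ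
    N = suc N'

    weight : ℕ → ℕ
    weight i = indicator (hasPeaksᵇ (insertAt i (suc N) σ) T)

    private
      length-σ = permutation-length N σ∈
      σ<N+1 = permutation-< N σ∈
      interior = applyUpTo suc N'
      open InsertAtEnds N σ length-σ σ<N+1

    weight-front : weight 0 ≡ indicator (hasPeaksᵇ σ (map pred T))
    weight-front = cong indicator (hasPeaksᵇ-cong (suc N ∷ σ) T σ (map pred T) (HasPeaks-front⁻ T T≥2) (HasPeaks-front⁺ T T≥2))
      where T≥2 = separated-≥ 2 T sepT

    weight-back : weight N ≡ indicator (hasPeaksᵇ σ T)
    weight-back = cong indicator (hasPeaksᵇ-cong (insertAt N (suc N) σ) T σ T
      (λ h q → trans (sym (peakᵇ-insert-back q)) (h q)) (λ h q → trans (peakᵇ-insert-back q) (h q)))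

    -- an interior insertion at i creates the peak i + 1, so only i + 1 ∈ T can contribute
    weight-interior : ∀ {i} → i ∈ interior → weight i ≡ (if memᵇ (suc i) T then weight i else 0)
    weight-interior i∈ with ∈-applyUpTo⁻ suc i∈
    ... | j , j<N' , refl with memᵇ (suc (suc j)) T in eq
    ... | true  = refl
    ... | false = cong indicator (hasPeaksᵇ-false (insertAt (suc j) (suc N) σ) T
                    (λ h → contradiction (trans (sym new-peak) (trans (h (suc (suc j))) eq)) λ ()))
      where
      module I = InsertMaximum (suc j) (suc N) σ (subst (suc j ≤_) (sym length-σ) (≤-trans j<N' (n≤1+n _))) (s≤s z≤n) σ<N+1
      new-peak : peakᵇ I.π (suc (suc j)) ≡ true
      new-peak = I.peakᵇ-maximum (s≤s z≤n) (subst (suc (suc j) ≤_) (sym length-σ) (s≤s j<N'))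

    weight-pivot : ∀ {s} → s ∈ splittings T → weight (pred (pivot s)) ≡ ∑𝔹² (λ b₁ b₂ → indicator (hasPeaksᵇ σ (childSet s b₁ b₂)))
    weight-pivot {xs , p , ys} s∈ with splitting-shape 2 T sepT s∈
    ... | T≡ , xs<p , ys>p , 2≤p = go p 2≤p T≡ xs<p ys>p (All.lookup T≤ (subst (p ∈_) (sym T≡) (∈-++⁺ʳ xs (here refl))))
      where
      go : ∀ p → 2 ≤ p → T ≡ xs ++ p ∷ ys → All (λ a → suc (suc a) ≤ p) xs → All (λ b → suc (suc p) ≤ b) ys → p ≤ N →
           weight (pred p) ≡ ∑𝔹² (λ b₁ b₂ → indicator (hasPeaksᵇ σ (childSet (xs , p , ys) b₁ b₂)))
      go (suc i) (s≤s 1≤i) T≡ xs<p ys>p p≤N =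
        trans (cong indicator (trans (cong (hasPeaksᵇ π) T≡)
                (hasPeaksᵇ-cong π whole σ (child β₁ β₂) HasPeaks-insert⁻ (HasPeaks-insert⁺ β₁ β₂))))
              (sym (∑𝔹²-single (λ b₁ b₂ → indicator (hasPeaksᵇ σ (child b₁ b₂))) β₁ β₂ support))
        where
        open InsertAtPeak N σ length-σ σ<N+1 xs i ys xs<p ys>p 1≤i p≤N
        support : ∀ b₁ b₂ → indicator (hasPeaksᵇ σ (child b₁ b₂)) ≢ 0 → b₁ ≡ β₁ × b₂ ≡ β₂
        support b₁ b₂ ≢0 with hasPeaksᵇ σ (child b₁ b₂) in eq
        ... | true  = HasPeaks-child-flags b₁ b₂ (hasPeaksᵇ-sound σ (child b₁ b₂) eq)
        ... | false = contradiction refl ≢0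

    ∑-interior : ∑ interior weight ≡ ∑ (splittings T) (λ s → ∑𝔹² (λ b₁ b₂ → indicator (hasPeaksᵇ σ (childSet s b₁ b₂))))
    ∑-interior = begin
      ∑ interior weight
        ≡⟨ ∑-cong interior (λ _ → weight-interior) ⟩
      ∑ interior (λ i → if memᵇ (suc i) T then weight i else 0)
        ≡⟨ sym (∑-map suc interior (λ r → if memᵇ r T then weight (pred r) else 0)) ⟩
      ∑ (map suc interior) (λ r → if memᵇ r T then weight (pred r) else 0)
        ≡⟨ ∑-restrict T (map suc interior) (λ r → weight (pred r)) (separated-unique 2 T sepT) unique-positions T⊆ ⟩
      ∑ T (λ r → weight (pred r))
        ≡⟨ cong (λ L → ∑ L (λ r → weight (pred r))) (sym (map-pivot-splittings T)) ⟩
      ∑ (map pivot (splittings T)) (λ r → weight (pred r))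
        ≡⟨ ∑-map pivot (splittings T) (λ r → weight (pred r)) ⟩
      ∑ (splittings T) (λ s → weight (pred (pivot s)))
        ≡⟨ ∑-cong (splittings T) (λ _ → weight-pivot) ⟩
      ∑ (splittings T) (λ s → ∑𝔹² (λ b₁ b₂ → indicator (hasPeaksᵇ σ (childSet s b₁ b₂)))) ∎
      where
      open ≡-Reasoning
      unique-positions : Unique (map suc interior)
      unique-positions = Unique.map⁺ suc-injective (Unique.applyUpTo⁺₁ suc N' (λ i<j _ e → <-irrefl (suc-injective e) i<j))
      T⊆ : ∀ {a} → a ∈ T → a ∈ map suc interior
      T⊆ a∈ with All.lookup (separated-≥ 2 T sepT) a∈ | All.lookup T≤ a∈
      ... | s≤s (s≤s _) | s≤s a≤ = ∈-map⁺ suc (∈-applyUpTo⁺ suc a≤)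

    ∑-insertions : ∑ (upTo (suc N)) weight ≡
      indicator (hasPeaksᵇ σ (map pred T)) + (∑ (splittings T) (λ s → ∑𝔹² (λ b₁ b₂ → indicator (hasPeaksᵇ σ (childSet s b₁ b₂))))
                                             + indicator (hasPeaksᵇ σ T))
    ∑-insertions = trans (cong (λ L → ∑ L weight) (cong (0 ∷_) (sym (applyUpTo-∷ʳ suc N'))))
      (cong₂ _+_ weight-front (trans (∑-++ interior (N ∷ []) weight) (cong₂ _+_ ∑-interior (trans (+-identityʳ (weight N)) weight-back))))

  ∑-raised : ∀ (h : List ℕ → ℕ) T →
             ∑ (splittings T) (λ s → h (raised s)) + h (map pred T) ≡ ∑ (splittings T) (λ s → h (lowered s)) + h T
  ∑-raised h []       = refl
  ∑-raised h (a ∷ as) = begin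
      X + R + Y                          ≡⟨ cong (λ w → X + w + Y) (∑-map (extendˡ a) (splittings as) (λ s → h (raised s))) ⟩
      X + R' + Y                         ≡⟨ cong (_+ Y) (+-comm X R') ⟩
      R' + X + Y                         ≡⟨ cong (_+ Y) (∑-raised (λ L → h (a ∷ L)) as) ⟩
      L' + Z + Y                         ≡⟨ solve 3 (λ l z y → l :+ z :+ y := y :+ l :+ z) refl L' Z Y ⟩
      Y + L' + Z                         ≡⟨ cong (λ w → Y + w + Z) (sym (∑-map (extendˡ a) (splittings as) (λ s → h (lowered s)))) ⟩
      Y + L + Z                          ∎
    where
    open ≡-Reasoning
    open +-*-Solver
    R  = ∑ (map (extendˡ a) (splittings as)) (λ s → h (raised s))
    L  = ∑ (map (extendˡ a) (splittings as)) (λ s → h (lowered s))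
    R' = ∑ (splittings as) (λ s → h (a ∷ raised s))
    L' = ∑ (splittings as) (λ s → h (a ∷ lowered s))
    X  = h (a ∷ map pred as)
    Y  = h (pred a ∷ map pred as)
    Z  = h (a ∷ as)

  ¬HasPeaks-both-sides : ∀ T σ {s} → Separated T → s ∈ splittings T → ¬ HasPeaks σ (childSet s true true)
  ¬HasPeaks-both-sides T σ {xs , p , ys} sepT s∈ with splitting-shape 2 T sepT s∈
  ¬HasPeaks-both-sides T σ {xs , suc i , ys} sepT s∈ | _ , xs<p , ys>p , _ = λ h →
    peakᵇ-not-adjacent σ i (trans (h i) (memᵇ-child-i true true)) (trans (h (suc i)) (memᵇ-child-p true true))
    where open Split xs i ys xs<p ys>p

  ∑-∑𝔹² : {A : Set} (xs : List A) (f : A → Bool → Bool → ℕ) →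
          ∑ xs (λ x → ∑𝔹² (f x)) ≡ ∑𝔹² (λ b₁ b₂ → ∑ xs (λ x → f x b₁ b₂))
  ∑-∑𝔹² xs f = trans (∑-+ xs (λ x → f x false false) _)
     (cong (∑ xs (λ x → f x false false) +_) (trans (∑-+ xs (λ x → f x true false) _)
     (cong (∑ xs (λ x → f x true false) +_) (∑-+ xs (λ x → f x false true) _))))

  peakCount-insertions : ∀ N' T → Separated T → All (_≤ suc N') T →
    peakCount T (suc (suc N')) ≡
    peakCount (map pred T) (suc N')
      + (∑ (splittings T) (λ s → ∑𝔹² (λ b₁ b₂ → peakCount (childSet s b₁ b₂) (suc N'))) + peakCount T (suc N'))
  peakCount-insertions N' T sepT T≤ = begin
    peakCount T (suc N)
      ≡⟨ ∑-concatMap (insertions (suc N)) (permutations N) (λ π → indicator (hasPeaksᵇ π T)) ⟩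
    ∑ (permutations N) (λ σ → ∑ (insertions (suc N) σ) (λ π → indicator (hasPeaksᵇ π T)))
      ≡⟨ ∑-cong (permutations N) (λ σ σ∈ → trans (∑-map (λ i → insertAt i (suc N) σ) (upTo (suc N)) (λ π → indicator (hasPeaksᵇ π T)))
                                                  (InsertionsOf.∑-insertions N' σ∈ T sepT T≤)) ⟩
    ∑ (permutations N) (λ σ → indicator (hasPeaksᵇ σ (map pred T)) + (children σ + indicator (hasPeaksᵇ σ T)))
      ≡⟨ trans (∑-+ (permutations N) _ _) (cong (peakCount (map pred T) N +_) (∑-+ (permutations N) _ _)) ⟩
    peakCount (map pred T) N + (∑ (permutations N) children + peakCount T N)
      ≡⟨ cong (λ w → peakCount (map pred T) N + (w + peakCount T N)) (trans
           (∑-comm (permutations N) (splittings T) (λ σ s → ∑𝔹² (λ b₁ b₂ → indicator (hasPeaksᵇ σ (childSet s b₁ b₂)))))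
           (∑-cong (splittings T) (λ s _ → ∑-∑𝔹² (permutations N) (λ σ b₁ b₂ → indicator (hasPeaksᵇ σ (childSet s b₁ b₂)))))) ⟩
    peakCount (map pred T) N + (∑ (splittings T) (λ s → ∑𝔹² (λ b₁ b₂ → peakCount (childSet s b₁ b₂) N)) + peakCount T N) ∎
    where
    open ≡-Reasoning
    N = suc N'
    children : List ℕ → ℕ
    children σ = ∑ (splittings T) (λ s → ∑𝔹² (λ b₁ b₂ → indicator (hasPeaksᵇ σ (childSet s b₁ b₂))))

  peakCount-recursion : ∀ N' T → Separated T → All (_≤ suc N') T →
    peakCount T (suc (suc N')) ≡ 2 * peakCount T (suc N') + ∑ (splittings T) (λ s → peakCount (deleted s) (suc N'))
                                 + 2 * ∑ (splittings T) (λ s → peakCount (lowered s) (suc N'))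
  peakCount-recursion N' T sepT T≤ = begin
    peakCount T (suc N)                                        ≡⟨ peakCount-insertions N' T sepT T≤ ⟩
    P + (∑ (splittings T) (λ s → ∑𝔹² (λ b₁ b₂ → peakCount (childSet s b₁ b₂) N)) + C)
                                                               ≡⟨ cong (λ w → P + (w + C)) ∑-children ⟩
    P + (D + (L + (R + 0)) + C)                                ≡⟨ solve 5 (λ p d l r c → p :+ (d :+ (l :+ (r :+ con 0)) :+ c)
                                                                              := d :+ l :+ (r :+ p) :+ c) refl P D L R C ⟩
    D + L + (R + P) + C                                        ≡⟨ cong (λ w → D + L + w + C) (∑-raised (λ U → peakCount U N) T) ⟩
    D + L + (L + C) + C                                        ≡⟨ solve 3 (λ d l c → d :+ l :+ (l :+ c) :+ c
                                                                              := con 2 :* c :+ d :+ con 2 :* l) refl D L C ⟩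
    2 * C + D + 2 * L                                          ∎
    where
    open ≡-Reasoning
    open +-*-Solver
    N = suc N'
    P = peakCount (map pred T) N
    C = peakCount T N
    D = ∑ (splittings T) (λ s → peakCount (deleted s) N)
    L = ∑ (splittings T) (λ s → peakCount (lowered s) N)
    R = ∑ (splittings T) (λ s → peakCount (raised s) N)
    ∑-children : ∑ (splittings T) (λ s → ∑𝔹² (λ b₁ b₂ → peakCount (childSet s b₁ b₂) N)) ≡ D + (L + (R + 0))
    ∑-children = trans (∑-∑𝔹² (splittings T) (λ s b₁ b₂ → peakCount (childSet s b₁ b₂) N))
      (cong (λ w → D + (L + (R + w)))
        (∑-zero (splittings T) (λ s s∈ → peakCount-zero (childSet s true true) N (λ σ _ → ¬HasPeaks-both-sides T σ sepT s∈))))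


module CombinatorialPeakPolynomial where

  open import Data.Nat using (ℕ; zero; suc; _+_; _*_; _∸_; _^_; _≤_; z≤n; s≤s; pred; _⊔_; _≤ᵇ_)
  open import Data.Nat.Properties
    using (≤-trans; ≤-refl; n≤1+n; pred-mono-≤; pred[n]≤n; m≤m⊔n; m≤n⊔m; ⊔-lub; ⊔-sel; ⊔-identityʳ; m≤n⇒m<n∨m≡n;
           +-identityʳ; +-suc; +-∸-assoc; m+[n∸m]≡n; n∸n≡0; 0≢1+n; suc-injective; m≤m+n)
  open import Data.Nat.Solver using (module +-*-Solver)
  open import Data.Bool using (true; false; if_then_else_)
  open import Data.List using (List; []; _∷_; map; length; upTo)
  open import Data.List.Properties using (applyUpTo-∷ʳ; length-++; length-map)
  open import Data.List.Membership.Propositional using (_∈_)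
  open import Data.List.Membership.Propositional.Properties using (∈-map⁻)
  open import Data.List.Relation.Unary.Any using (here; there)
  open import Data.List.Relation.Unary.All using (All; []; _∷_)
  import Data.List.Relation.Unary.All as All
  import Data.List.Relation.Unary.All.Properties as All
  open import Data.Product using (_×_; _,_; proj₁)
  open import Data.Sum using (inj₁; inj₂)
  open import Data.Unit using (⊤; tt)
  open import Relation.Binary.PropositionalEquality using (_≡_; refl; sym; trans; cong; cong₂; subst; module ≡-Reasoning)
  open import Relation.Nullary using (contradiction)
  open import Function using (_∘_)
  open ListSum
  open Permutations using (permutation-length)
  open PeakIndicator
  open PeakSets
  open PeakCounting
  open Splittings
  open InsertionRecursion using (peakCount-recursion)

  maximum : List ℕ → ℕ
  maximum []       = 0
  maximum (a ∷ as) = a ⊔ maximum as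

  ≤-maximum : ∀ C → All (_≤ maximum C) C
  ≤-maximum []      = []
  ≤-maximum (a ∷ C) = m≤m⊔n a (maximum C) ∷ All.map (λ h → ≤-trans h (m≤n⊔m a (maximum C))) (≤-maximum C)

  maximum-≤ : ∀ C {b} → All (_≤ b) C → maximum C ≤ b
  maximum-≤ []      _        = z≤n
  maximum-≤ (a ∷ C) (h ∷ hs) = ⊔-lub h (maximum-≤ C hs)

  maximum-∈ : ∀ a C → maximum (a ∷ C) ∈ a ∷ C
  maximum-∈ a []      = here (⊔-identityʳ a)
  maximum-∈ a (c ∷ C) with ⊔-sel a (maximum (c ∷ C))
  ... | inj₁ eq = here eq
  ... | inj₂ eq = there (subst (_∈ c ∷ C) (sym eq) (maximum-∈ c C))

  separated-head : ∀ a as → Separated (a ∷ as) → 2 ≤ a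
  separated-head a as sep = ≤ᵇ-sound (proj₁ (∧-true⁻ {2 ≤ᵇ a} sep))

  separated-maximum : ∀ a as → Separated (a ∷ as) → 2 ≤ maximum (a ∷ as)
  separated-maximum a as sep = ≤-trans (separated-head a as sep) (m≤m⊔n a (maximum as))

  IncreasingFrom : ℕ → List ℕ → Set
  IncreasingFrom lo []       = ⊤
  IncreasingFrom lo (a ∷ as) = lo ≤ a × IncreasingFrom (suc a) as

  IncreasingFrom-weaken : ∀ {lo lo'} C → lo ≤ lo' → IncreasingFrom lo' C → IncreasingFrom lo C
  IncreasingFrom-weaken []      _     _          = tt
  IncreasingFrom-weaken (a ∷ C) lo≤ (lo'≤a , h) = ≤-trans lo≤ lo'≤a , h

  separated⇒increasing-pred : ∀ lo as → separatedᵇ lo as ≡ true → IncreasingFrom (pred lo) (map pred as)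
  separated⇒increasing-pred lo []       _  = tt
  separated⇒increasing-pred lo (c ∷ cs) eq with ∧-true⁻ {lo ≤ᵇ c} eq
  ... | lo≤c , rest = pred-mono-≤ (≤ᵇ-sound {lo} {c} lo≤c)
                    , IncreasingFrom-weaken (map pred cs) (s≤s (pred[n]≤n {c})) (separated⇒increasing-pred _ cs rest)

  childSet-increasing : ∀ lo T b {s} → separatedᵇ lo T ≡ true → s ∈ splittings T → IncreasingFrom (pred lo) (childSet s b false)
  childSet-increasing lo (a ∷ as) b {s} eq s∈ with ∧-true⁻ {lo ≤ᵇ a} eq | s∈
  childSet-increasing lo (a ∷ as) true  eq s∈ | lo≤a , rest | here refl =
    pred-mono-≤ (≤ᵇ-sound {lo} {a} lo≤a) , IncreasingFrom-weaken (map pred as) (s≤s (pred[n]≤n {a})) (separated⇒increasing-pred _ as rest)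
  childSet-increasing lo (a ∷ as) false eq s∈ | lo≤a , rest | here refl =
    IncreasingFrom-weaken (map pred as) (≤-trans (pred-mono-≤ (≤ᵇ-sound {lo} {a} lo≤a)) (≤-trans pred[n]≤n (n≤1+n a)))
                          (separated⇒increasing-pred _ as rest)
  childSet-increasing lo (a ∷ as) b     eq s∈ | lo≤a , rest | there s∈' with ∈-map⁻ (extendˡ a) {xs = splittings as} s∈'
  ... | _ , s∈'' , refl = ≤-trans (pred-mono-≤ (≤ᵇ-sound {lo} {a} lo≤a)) pred[n]≤n , childSet-increasing (suc (suc a)) as b rest s∈''

  increasing-peaks⇒separated : ∀ σ C → IncreasingFrom 0 C → (∀ {a} → a ∈ C → peakᵇ σ a ≡ true) → Separated C
  increasing-peaks⇒separated σ []      _          _     = refl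
  increasing-peaks⇒separated σ (b ∷ C) (_ , inc) peaks rewrite ≤ᵇ-true (proj₁ (peakᵇ-range σ b (peaks (here refl)))) =
    after b C inc (peaks (here refl)) (peaks ∘ there)
    where
    after : ∀ a₀ C → IncreasingFrom (suc a₀) C → peakᵇ σ a₀ ≡ true → (∀ {a} → a ∈ C → peakᵇ σ a ≡ true) →
            separatedᵇ (suc (suc a₀)) C ≡ true
    after a₀ []      _              _    _     = refl
    after a₀ (b ∷ C) (a₀<b , inc) pa₀ peaks with m≤n⇒m<n∨m≡n a₀<b
    ... | inj₂ refl = contradiction (peaks (here refl)) (λ pb → peakᵇ-not-adjacent σ a₀ pa₀ pb)
    ... | inj₁ a₀+1<b rewrite ≤ᵇ-true a₀+1<b = after b C inc (peaks (here refl)) (peaks ∘ there)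

  peakCount-unseparated : ∀ C N → IncreasingFrom 0 C → separatedᵇ 2 C ≡ false → peakCount C N ≡ 0
  peakCount-unseparated C N inc unsep = peakCount-zero C N λ σ _ h →
    contradiction (trans (sym (increasing-peaks⇒separated σ C inc (λ {a} a∈ → trans (h a) (∈⇒memᵇ a C a∈)))) unsep) λ ()

  -- a permutation of [m] has no peak at position m
  peakCount-maximum : ∀ a as → peakCount (a ∷ as) (maximum (a ∷ as)) ≡ 0
  peakCount-maximum a as = peakCount-zero (a ∷ as) m λ σ σ∈ h →
    contradiction (trans (sym (∈⇒memᵇ m (a ∷ as) (maximum-∈ a as))) (trans (sym (h m))
      (peakᵇ-beyond σ m (subst (_≤ m) (sym (permutation-length m σ∈)) ≤-refl)))) λ ()
    where m = maximum (a ∷ as)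

  childSet-≤ : ∀ T b {s} → Separated T → s ∈ splittings T → All (_≤ pred (maximum T)) (childSet s b false)
  childSet-≤ T b {xs , p , ys} sepT s∈ with splitting-shape 2 T sepT s∈
  ... | T≡ , xs<p , _ , _ =
    All.++⁺ (All.map (λ {x} h → ≤-trans (≤-trans (n≤1+n x) (pred-mono-≤ h)) (pred-mono-≤ p≤)) xs<p)
            (All.++⁺ (optional-≤ b) (All.map⁺ (All.map pred-mono-≤ ys≤)))
    where
    T≤ = subst (All (_≤ maximum T)) T≡ (≤-maximum T)
    p≤ : p ≤ maximum T
    p≤ = All.head (All.++⁻ʳ xs T≤)
    ys≤ : All (_≤ maximum T) ys
    ys≤ = All.tail (All.++⁻ʳ xs T≤)
    optional-≤ : ∀ b → All (_≤ pred (maximum T)) (optional b (pred p))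
    optional-≤ true  = pred-mono-≤ p≤ ∷ []
    optional-≤ false = []

  length-deleted : ∀ T {s} → Separated T → s ∈ splittings T → length T ≡ suc (length (deleted s))
  length-deleted T {xs , p , ys} sepT s∈ with splitting-shape 2 T sepT s∈
  ... | T≡ , _ = trans (cong length T≡) (trans (length-++ xs) (trans (+-suc (length xs) (length ys))
                   (cong suc (sym (trans (length-++ xs) (cong (length xs +_) (length-map pred ys)))))))

  length-lowered : ∀ T {s} → Separated T → s ∈ splittings T → length T ≡ length (lowered s)
  length-lowered T {xs , p , ys} sepT s∈ with splitting-shape 2 T sepT s∈
  ... | T≡ , _ = trans (cong length T≡) (trans (length-++ xs)
                   (sym (trans (length-++ xs) (cong (λ n → length xs + suc n) (length-map pred ys)))))

  ∑from : (ℕ → ℕ) → ℕ → ℕ → ℕ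
  ∑from g lo N = ∑ (upTo (N ∸ lo)) (λ t → g (lo + t))

  ∑from-empty : ∀ g lo → ∑from g lo lo ≡ 0
  ∑from-empty g lo rewrite n∸n≡0 lo = refl

  ∑from-suc : ∀ g lo N → lo ≤ N → ∑from g lo (suc N) ≡ ∑from g lo N + g N
  ∑from-suc g lo N lo≤N = trans (cong (λ k → ∑ (upTo k) shifted) (+-∸-assoc 1 lo≤N))
     (trans (cong (λ L → ∑ L shifted) (sym (applyUpTo-∷ʳ (λ x → x) (N ∸ lo))))
     (trans (∑-++ (upTo (N ∸ lo)) ((N ∸ lo) ∷ []) shifted)
       (cong (∑from g lo N +_) (trans (+-identityʳ _) (cong g (m+[n∸m]≡n lo≤N))))))
    where shifted = λ t → g (lo + t)

  -- p_T(N) for N ≥ max T, defined through the recursion with p_T(max T) = 0; the fuel F only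
  -- has to exceed the recursion depth, and F ≥ max T suffices (on fuel 0 the value is junk)
  mutual
    peakPoly : ℕ → List ℕ → ℕ → ℕ
    peakPoly F       []       N = 1
    peakPoly zero    (a ∷ as) N = 0
    peakPoly (suc F) (a ∷ as) N = ∑from (childrenSum F (a ∷ as)) (maximum (a ∷ as)) N

    childrenSum : ℕ → List ℕ → ℕ → ℕ
    childrenSum F T N = ∑ (splittings T) (λ s → peakPolyIfSeparated F (deleted s) N + peakPolyIfSeparated F (lowered s) N)

    peakPolyIfSeparated : ℕ → List ℕ → ℕ → ℕ
    peakPolyIfSeparated F C N = if separatedᵇ 2 C then peakPoly F C N else 0

  peakCount-[] : ∀ N → 1 ≤ N → peakCount [] N * 2 ≡ 2 ^ N
  peakCount-[] (suc zero)      _ = refl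
  peakCount-[] (suc (suc N')) _ = trans (cong (_* 2) (peakCount-recursion N' [] refl []))
    (trans (solve 1 (λ c → (con 2 :* c :+ con 0 :+ con 2 :* con 0) :* con 2 := con 2 :* (c :* con 2)) refl (peakCount [] (suc N')))
      (cong (2 *_) (peakCount-[] (suc N') (s≤s z≤n))))
    where open +-*-Solver

  peakCount-step : ∀ F' T → Separated T → ∀ N' → All (_≤ suc N') T →
    (∀ b {s} → s ∈ splittings T → peakCount (childSet s b false) (suc N') * 2 ^ suc (length (childSet s b false))
                                  ≡ peakPolyIfSeparated F' (childSet s b false) (suc N') * 2 ^ suc N') →
    ∀ P → peakCount T (suc N') * 2 ^ suc (length T) ≡ P * 2 ^ suc N' →
    peakCount T (suc (suc N')) * 2 ^ suc (length T) ≡ (P + childrenSum F' T (suc N')) * 2 ^ suc (suc N')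
  peakCount-step F' T sepT N' T≤ children P hyp = begin
    peakCount T (suc N) * K                              ≡⟨ cong (_* K) (peakCount-recursion N' T sepT T≤) ⟩
    (2 * C + D + 2 * L) * K                              ≡⟨ solve 4 (λ c d l k → (con 2 :* c :+ d :+ con 2 :* l) :* k
                                                                    := con 2 :* (c :* k) :+ d :* k :+ con 2 :* (l :* k)) refl C D L K ⟩
    2 * (C * K) + D * K + 2 * (L * K)                    ≡⟨ cong₂ _+_ (cong₂ _+_ (cong (2 *_) hyp) deleted-term) (cong (2 *_) lowered-term) ⟩
    2 * (P * E) + 2 * (A * E) + 2 * (B * E)              ≡⟨ solve 4 (λ p a b e → con 2 :* (p :* e) :+ con 2 :* (a :* e) :+ con 2 :* (b :* e)
                                                                    := (p :+ (a :+ b)) :* (con 2 :* e)) refl P A B E ⟩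
    (P + (A + B)) * (2 * E)                              ≡⟨ cong (λ w → (P + w) * (2 * E)) (sym (∑-+ (splittings T) _ _)) ⟩
    (P + childrenSum F' T N) * 2 ^ suc N                 ∎
    where
    open ≡-Reasoning
    open +-*-Solver
    N = suc N'
    K = 2 ^ suc (length T)
    E = 2 ^ N
    C = peakCount T N
    D = ∑ (splittings T) (λ s → peakCount (deleted s) N)
    L = ∑ (splittings T) (λ s → peakCount (lowered s) N)
    A = ∑ (splittings T) (λ s → peakPolyIfSeparated F' (deleted s) N)
    B = ∑ (splittings T) (λ s → peakPolyIfSeparated F' (lowered s) N)
    deleted-term : D * K ≡ 2 * (A * E)
    deleted-term = trans (∑-*ʳ (splittings T) _ K) (trans (∑-cong (splittings T) {g = λ s → 2 * (peakPolyIfSeparated F' (deleted s) N * E)}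
      (λ s s∈ → trans (cong (λ n → peakCount (deleted s) N * 2 ^ suc n) (length-deleted T sepT s∈))
                (trans (solve 2 (λ c w → c :* (con 2 :* w) := con 2 :* (c :* w)) refl (peakCount (deleted s) N) (2 ^ suc (length (deleted s))))
                       (cong (2 *_) (children false s∈)))))
      (trans (∑-*ˡ 2 (splittings T) _) (cong (2 *_) (sym (∑-*ʳ (splittings T) _ E)))))
    lowered-term : L * K ≡ B * E
    lowered-term = trans (∑-*ʳ (splittings T) _ K) (trans (∑-cong (splittings T) {g = λ s → peakPolyIfSeparated F' (lowered s) N * E}
      (λ s s∈ → trans (cong (λ n → peakCount (lowered s) N * 2 ^ suc n) (length-lowered T sepT s∈)) (children true s∈)))
      (sym (∑-*ʳ (splittings T) _ E)))

  -- |𝒫_T(N)| = p_T(N) 2^{N − |T| − 1}, multiplied out so that no subtraction occurs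
  peakCount≡peakPoly : ∀ F T → Separated T → maximum T ≤ F → ∀ N → maximum T ≤ N → 1 ≤ N →
                       peakCount T N * 2 ^ suc (length T) ≡ peakPoly F T N * 2 ^ N
  peakCount≡peakPoly F       []       _   _   N _   1≤N = trans (peakCount-[] N 1≤N) (sym (+-identityʳ (2 ^ N)))
  peakCount≡peakPoly zero    (a ∷ as) sep m≤0 = contradiction (≤-trans (separated-maximum a as sep) m≤0) λ ()
  peakCount≡peakPoly (suc F) (a ∷ as) sep m≤F N₀ m≤N₀ _ = from-maximum (N₀ ∸ m) N₀ (m+[n∸m]≡n m≤N₀)
    where
    T = a ∷ as
    m = maximum T
    child : ∀ b {s} N → s ∈ splittings T → m ≤ N → 1 ≤ N →
            peakCount (childSet s b false) N * 2 ^ suc (length (childSet s b false)) ≡ peakPolyIfSeparated F (childSet s b false) N * 2 ^ N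
    child b {s} N s∈ m≤N 1≤N with separatedᵇ 2 (childSet s b false) in sep'
    ... | true  = peakCount≡peakPoly F (childSet s b false) sep' (≤-trans child≤ (pred-mono-≤ m≤F))
                                     N (≤-trans child≤ (≤-trans pred[n]≤n m≤N)) 1≤N
      where child≤ = maximum-≤ (childSet s b false) (childSet-≤ T b sep s∈)
    ... | false rewrite peakCount-unseparated (childSet s b false) N
                          (IncreasingFrom-weaken (childSet s b false) z≤n (childSet-increasing 2 T b sep s∈)) sep' = refl
    from-maximum : ∀ d N → m + d ≡ N → peakCount T N * 2 ^ suc (length T) ≡ peakPoly (suc F) T N * 2 ^ N
    from-maximum zero N refl rewrite +-identityʳ m | peakCount-maximum a as | ∑from-empty (childrenSum F T) m = refl
    from-maximum (suc d) zero eq = contradiction (trans (sym eq) (+-suc m d)) λ ()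
    from-maximum (suc d) (suc zero) eq =
      contradiction (subst (2 ≤_) eq (≤-trans (separated-maximum a as sep) (m≤m+n m (suc d)))) λ { (s≤s ()) }
    from-maximum (suc d) (suc (suc N')) eq =
      trans (peakCount-step F T sep N' T≤ (λ b s∈ → child b (suc N') s∈ m≤N (s≤s z≤n)) (peakPoly (suc F) T (suc N'))
                               (from-maximum d (suc N') m+d≡N))
            (cong (_* 2 ^ suc (suc N')) (sym (∑from-suc (childrenSum F T) m (suc N') m≤N)))
      where
      m+d≡N = suc-injective (trans (sym (+-suc m d)) eq)
      m≤N : m ≤ suc N'
      m≤N = subst (m ≤_) m+d≡N (m≤m+n m d)
      T≤ : All (_≤ suc N') T
      T≤ = All.map (λ h → ≤-trans h m≤N) (≤-maximum T)


module NatEmbedding where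

  open import Data.Nat as ℕ using (ℕ; zero; suc)
  open import Data.Integer as ℤ using (+_)
  import Data.Integer.Properties as ℤ
  open import Data.Integer.Solver using (module +-*-Solver)
  open import Data.Rational as ℚ using (ℚ; 0ℚ; _+_; _*_; _≤_; _<_; toℚᵘ)
  import Data.Rational.Properties as ℚ
  import Data.Rational.Unnormalised as ℚᵘ
  import Data.Rational.Unnormalised.Properties as ℚᵘ
  open import Relation.Binary.PropositionalEquality using (_≡_; refl; sym; trans; cong)
  open import Defs using (ℕtoℚ; pow2)

  opaque
    ι : ℕ → ℚ
    ι = ℕtoℚ

    ι≡ℕtoℚ : ∀ k → ι k ≡ ℕtoℚ k
    ι≡ℕtoℚ k = refl

    private
      ιᵘ : ℕ → ℚᵘ.ℚᵘ
      ιᵘ n = ℚᵘ.mkℚᵘ (+ n) 0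

      toℚᵘ-ι : ∀ n → toℚᵘ (ι n) ℚᵘ.≃ ιᵘ n
      toℚᵘ-ι n = ℚ.toℚᵘ-fromℚᵘ (ιᵘ n)

    ι-+ : ∀ a b → ι (a ℕ.+ b) ≡ ι a + ι b
    ι-+ a b = ℚ.toℚᵘ-injective (ℚᵘ.≃-trans (toℚᵘ-ι (a ℕ.+ b)) (ℚᵘ.≃-trans homo
                (ℚᵘ.≃-sym (ℚᵘ.≃-trans (ℚ.toℚᵘ-homo-+ (ι a) (ι b)) (ℚᵘ.+-cong (toℚᵘ-ι a) (toℚᵘ-ι b))))))
      where
      open +-*-Solver
      homo : ιᵘ (a ℕ.+ b) ℚᵘ.≃ (ιᵘ a ℚᵘ.+ ιᵘ b)
      homo = ℚᵘ.*≡* (trans (cong (ℤ._* + 1) (ℤ.pos-+ a b))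
               (solve 2 (λ x y → (x :+ y) :* con (+ 1) := (x :* con (+ 1) :+ y :* con (+ 1)) :* con (+ 1)) refl (+ a) (+ b)))

    ι-* : ∀ a b → ι (a ℕ.* b) ≡ ι a * ι b
    ι-* a b = ℚ.toℚᵘ-injective (ℚᵘ.≃-trans (toℚᵘ-ι (a ℕ.* b)) (ℚᵘ.≃-trans homo
                (ℚᵘ.≃-sym (ℚᵘ.≃-trans (ℚ.toℚᵘ-homo-* (ι a) (ι b)) (ℚᵘ.*-cong (toℚᵘ-ι a) (toℚᵘ-ι b))))))
      where
      homo : ιᵘ (a ℕ.* b) ℚᵘ.≃ (ιᵘ a ℚᵘ.* ιᵘ b)
      homo = ℚᵘ.*≡* (cong (ℤ._* + 1) (ℤ.pos-* a b))

    ι-0 : ι 0 ≡ 0ℚ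
    ι-0 = refl

    ι-1 : ι 1 ≡ ℚ.1ℚ
    ι-1 = refl

    0≤ι : ∀ n → 0ℚ ≤ ι n
    0≤ι n = ℚ.nonNegative⁻¹ (ι n) {{ℚ.normalize-nonNeg n 1}}

    0<ι-suc : ∀ n → 0ℚ < ι (suc n)
    0<ι-suc n = ℚ.positive⁻¹ (ι (suc n)) {{ℚ.normalize-pos (suc n) 1}}

    ι-nonZero : ∀ n .{{_ : ℕ.NonZero n}} → ℚ.NonZero (ι n)
    ι-nonZero (suc n) = ℚ.pos⇒nonZero (ι (suc n)) {{ℚ.normalize-pos (suc n) 1}}

    pow2≡ι : ∀ n → pow2 n ≡ ι (2 ℕ.^ n)
    pow2≡ι zero    = refl
    pow2≡ι (suc n) = trans (cong (ι 2 *_) (pow2≡ι n)) (sym (ι-* 2 (2 ℕ.^ n)))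


module FiniteDifferences where

  open import Data.Nat as ℕ using (ℕ; zero; suc; z≤n)
  import Data.Nat.Properties as ℕ
  open import Data.Rational using (ℚ; 0ℚ; _+_; _-_; -_; _≤_; _<_)
  import Data.Rational.Properties as ℚ
  open import Data.Rational.Solver using (module +-*-Solver)
  open import Data.List using (List; []; _∷_)
  open import Data.List.Membership.Propositional using (_∈_)
  open import Data.List.Relation.Unary.Any using (here; there)
  open import Relation.Binary.PropositionalEquality using (_≡_; refl; trans; cong; cong₂; subst; module ≡-Reasoning)
  open +-*-Solver
  open ListSum using (∑)
  open NatEmbedding

  Δₛ : (ℕ → ℚ) → ℕ → ℚ
  Δₛ f k = f (suc k) - f k

  Δₛ^ : ℕ → (ℕ → ℚ) → ℕ → ℚ
  Δₛ^ zero    f = f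
  Δₛ^ (suc j) f = Δₛ (Δₛ^ j f)

  Δₛ^-suc : ∀ j f k → Δₛ^ (suc j) f k ≡ Δₛ^ j (Δₛ f) k
  Δₛ^-suc zero    f k = refl
  Δₛ^-suc (suc j) f k = cong₂ _-_ (Δₛ^-suc j f (suc k)) (Δₛ^-suc j f k)

  Δₛ^-cong-≥ : ∀ a {f g} → (∀ k → a ℕ.≤ k → f k ≡ g k) → ∀ j k → a ℕ.≤ k → Δₛ^ j f k ≡ Δₛ^ j g k
  Δₛ^-cong-≥ a f≡g zero    k a≤k = f≡g k a≤k
  Δₛ^-cong-≥ a f≡g (suc j) k a≤k =
    cong₂ _-_ (Δₛ^-cong-≥ a f≡g j (suc k) (ℕ.≤-trans a≤k (ℕ.n≤1+n k))) (Δₛ^-cong-≥ a f≡g j k a≤k)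

  Δₛ^-cong : ∀ {f g} → (∀ k → f k ≡ g k) → ∀ j k → Δₛ^ j f k ≡ Δₛ^ j g k
  Δₛ^-cong f≡g j k = Δₛ^-cong-≥ 0 (λ k _ → f≡g k) j k z≤n

  Δₛ^-+ : ∀ f g j k → Δₛ^ j (λ x → f x + g x) k ≡ Δₛ^ j f k + Δₛ^ j g k
  Δₛ^-+ f g zero    k = refl
  Δₛ^-+ f g (suc j) k rewrite Δₛ^-+ f g j (suc k) | Δₛ^-+ f g j k =
    solve 4 (λ a b c d → (a :+ b) :- (c :+ d) := (a :- c) :+ (b :- d)) refl (Δₛ^ j f (suc k)) (Δₛ^ j g (suc k)) (Δₛ^ j f k) (Δₛ^ j g k)

  Δₛ^-0 : ∀ j k → Δₛ^ j (λ _ → 0ℚ) k ≡ 0ℚ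
  Δₛ^-0 zero    k = refl
  Δₛ^-0 (suc j) k rewrite Δₛ^-0 j (suc k) | Δₛ^-0 j k = refl

  Δₛ^-const : ∀ c j k → Δₛ^ (suc j) (λ _ → c) k ≡ 0ℚ
  Δₛ^-const c j k = trans (Δₛ^-suc j (λ _ → c) k) (trans (Δₛ^-cong (λ _ → ℚ.+-inverseʳ c) j k) (Δₛ^-0 j k))

  agreement-at-threshold : ∀ a {f g} → (∀ k → suc a ℕ.≤ k → f k ≡ g k) → ∀ j → Δₛ^ j f a ≡ Δₛ^ j g a → f a ≡ g a
  agreement-at-threshold a beyond zero    Δ≡ = Δ≡
  agreement-at-threshold a {f} {g} beyond (suc j) Δ≡ = agreement-at-threshold a beyond j (begin
    Δₛ^ j f a                           ≡⟨ solve 2 (λ x y → y := x :- (x :- y)) refl (Δₛ^ j f (suc a)) (Δₛ^ j f a) ⟩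
    Δₛ^ j f (suc a) - Δₛ^ (suc j) f a   ≡⟨ cong₂ _-_ (Δₛ^-cong-≥ (suc a) beyond j (suc a) ℕ.≤-refl) Δ≡ ⟩
    Δₛ^ j g (suc a) - Δₛ^ (suc j) g a   ≡⟨ solve 2 (λ x y → x :- (x :- y) := y) refl (Δₛ^ j g (suc a)) (Δₛ^ j g a) ⟩
    Δₛ^ j g a                           ∎)
    where open ≡-Reasoning

  ∑ℚ : {A : Set} → List A → (A → ℚ) → ℚ
  ∑ℚ []       f = 0ℚ
  ∑ℚ (x ∷ xs) f = f x + ∑ℚ xs f

  ∑ℚ-cong : {A : Set} (xs : List A) {f g : A → ℚ} → (∀ x → x ∈ xs → f x ≡ g x) → ∑ℚ xs f ≡ ∑ℚ xs g
  ∑ℚ-cong []       h = refl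
  ∑ℚ-cong (x ∷ xs) h = cong₂ _+_ (h x (here refl)) (∑ℚ-cong xs (λ y y∈ → h y (there y∈)))

  ∑ℚ-zero : {A : Set} (xs : List A) {f : A → ℚ} → (∀ x → x ∈ xs → f x ≡ 0ℚ) → ∑ℚ xs f ≡ 0ℚ
  ∑ℚ-zero []       h = refl
  ∑ℚ-zero (x ∷ xs) h rewrite h x (here refl) | ∑ℚ-zero xs (λ y y∈ → h y (there y∈)) = refl

  Δₛ^-∑ℚ : ∀ {A : Set} (xs : List A) (F : A → ℕ → ℚ) j k →
           Δₛ^ j (λ x → ∑ℚ xs (λ a → F a x)) k ≡ ∑ℚ xs (λ a → Δₛ^ j (F a) k)
  Δₛ^-∑ℚ []       F j k = Δₛ^-0 j k
  Δₛ^-∑ℚ (a ∷ xs) F j k = trans (Δₛ^-+ (F a) (λ x → ∑ℚ xs (λ b → F b x)) j k) (cong (Δₛ^ j (F a) k +_) (Δₛ^-∑ℚ xs F j k))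

  ι-∑ : ∀ {A : Set} (xs : List A) (f : A → ℕ) → ι (∑ xs f) ≡ ∑ℚ xs (λ x → ι (f x))
  ι-∑ []       f = ι-0
  ι-∑ (x ∷ xs) f = trans (ι-+ (f x) (∑ xs f)) (cong (ι (f x) +_) (ι-∑ xs f))

  0≤+ : ∀ {a b} → 0ℚ ≤ a → 0ℚ ≤ b → 0ℚ ≤ a + b
  0≤+ {a} {b} p q = subst (_≤ a + b) (ℚ.+-identityʳ 0ℚ) (ℚ.+-mono-≤ p q)

  0<+ˡ : ∀ {a b} → 0ℚ < a → 0ℚ ≤ b → 0ℚ < a + b
  0<+ˡ {a} {b} p q = subst (_< a + b) (ℚ.+-identityʳ 0ℚ) (ℚ.+-mono-<-≤ p q)

  0<+ʳ : ∀ {a b} → 0ℚ ≤ a → 0ℚ < b → 0ℚ < a + b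
  0<+ʳ {a} {b} p q = subst (_< a + b) (ℚ.+-identityʳ 0ℚ) (ℚ.+-mono-≤-< p q)

  0≤∑ℚ : ∀ {A : Set} (xs : List A) {f} → (∀ x → x ∈ xs → 0ℚ ≤ f x) → 0ℚ ≤ ∑ℚ xs f
  0≤∑ℚ []       h = ℚ.≤-refl
  0≤∑ℚ (x ∷ xs) h = 0≤+ (h x (here refl)) (0≤∑ℚ xs (λ y y∈ → h y (there y∈)))

  0<∑ℚ : ∀ {A : Set} (xs : List A) {f x} → (∀ x → x ∈ xs → 0ℚ ≤ f x) → x ∈ xs → 0ℚ < f x → 0ℚ < ∑ℚ xs f
  0<∑ℚ (y ∷ xs) h (here refl) p = 0<+ˡ p (0≤∑ℚ xs (λ z z∈ → h z (there z∈)))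
  0<∑ℚ (y ∷ xs) h (there x∈)  p = 0<+ʳ (h y (here refl)) (0<∑ℚ xs (λ z z∈ → h z (there z∈)) x∈ p)


module PeakPolynomialDifferences where

  open import Data.Nat as ℕ using (ℕ; zero; suc; z≤n; s≤s; pred; _≤ᵇ_)
  import Data.Nat.Properties as ℕ
  open import Data.Rational using (ℚ; 0ℚ; _+_; _-_; _≤_; _<_)
  import Data.Rational.Properties as ℚ
  open import Data.Rational.Solver using (module +-*-Solver)
  open import Data.Bool using (Bool; true; false)
  open import Data.List using (List; []; _∷_; map)
  open import Data.List.Membership.Propositional using (_∈_)
  open import Data.List.Membership.Propositional.Properties using (∈-map⁺)
  open import Data.List.Relation.Unary.Any using (here; there)
  import Data.List.Relation.Unary.All as All
  open import Data.Product using (Σ; _×_; _,_)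
  open import Data.Sum using (_⊎_; inj₁; inj₂)
  open import Relation.Binary.PropositionalEquality using (_≡_; refl; sym; trans; cong; cong₂; subst; module ≡-Reasoning)
  open import Relation.Nullary using (contradiction)
  open PeakIndicator using (∧-true⁻; ≤ᵇ-true; ≤ᵇ-sound)
  open Splittings
  open CombinatorialPeakPolynomial
  open NatEmbedding
  open FiniteDifferences

  p̂ : ℕ → List ℕ → ℕ → ℚ
  p̂ F T k = ι (peakPoly F T k)

  p̂? : ℕ → List ℕ → ℕ → ℚ
  p̂? F C k = ι (peakPolyIfSeparated F C k)

  record DifferenceSigns (F : ℕ) (T : List ℕ) : Set where
    field
      Δ^-nonneg : ∀ j k → maximum T ℕ.≤ k → 0ℚ ≤ Δₛ^ j (p̂ F T) k
      Δ^-vanish : ∀ j k → maximum T ℕ.≤ k → maximum T ℕ.≤ j → 1 ℕ.≤ j → Δₛ^ j (p̂ F T) k ≡ 0ℚ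
      Δ^-pos    : ∀ j k → maximum T ℕ.≤ k → 1 ℕ.≤ j → suc j ℕ.≤ maximum T → 0ℚ < Δₛ^ j (p̂ F T) k
      value-pos : ∀ k → suc (maximum T) ℕ.≤ k → 0ℚ < p̂ F T k
  open DifferenceSigns

  DifferenceSigns-[] : ∀ F → DifferenceSigns F []
  DifferenceSigns-[] F = record
    { Δ^-nonneg = λ { zero k _ → 0≤ι 1 ; (suc j) k _ → subst (0ℚ ≤_) (sym (Δₛ^-const (ι 1) j k)) ℚ.≤-refl }
    ; Δ^-vanish = λ { zero k _ _ () ; (suc j) k _ _ _ → Δₛ^-const (ι 1) j k }
    ; Δ^-pos    = λ { j k _ _ () }
    ; value-pos = λ k _ → 0<ι-suc 0
    }

  Δ^ι0 : ∀ j k → Δₛ^ j (λ _ → ι 0) k ≡ 0ℚ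
  Δ^ι0 j k = trans (Δₛ^-cong (λ _ → ι-0) j k) (Δₛ^-0 j k)

  Δ^p̂?-nonneg : ∀ F C → (Separated C → DifferenceSigns F C) → ∀ j k → maximum C ℕ.≤ k → 0ℚ ≤ Δₛ^ j (p̂? F C) k
  Δ^p̂?-nonneg F C signs j k m≤k with separatedᵇ 2 C
  ... | true  = Δ^-nonneg (signs refl) j k m≤k
  ... | false = subst (0ℚ ≤_) (sym (Δ^ι0 j k)) ℚ.≤-refl

  Δ^p̂?-vanish : ∀ F C → (Separated C → DifferenceSigns F C) → ∀ j k → maximum C ℕ.≤ k → maximum C ℕ.≤ j → 1 ℕ.≤ j →
                Δₛ^ j (p̂? F C) k ≡ 0ℚ
  Δ^p̂?-vanish F C signs j k m≤k m≤j 1≤j with separatedᵇ 2 C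
  ... | true  = Δ^-vanish (signs refl) j k m≤k m≤j 1≤j
  ... | false = Δ^ι0 j k

  Δp̂ : ∀ F a as k → maximum (a ∷ as) ℕ.≤ k → Δₛ (p̂ (suc F) (a ∷ as)) k ≡ ι (childrenSum F (a ∷ as) k)
  Δp̂ F a as k m≤k = trans (cong (_- p̂ (suc F) T k) (trans (cong ι (∑from-suc (childrenSum F T) (maximum T) k m≤k))
                                                             (ι-+ (peakPoly (suc F) T k) (childrenSum F T k))))
                          (solve 2 (λ x y → (x :+ y) :- x := y) refl (p̂ (suc F) T k) (ι (childrenSum F T k)))
    where
    open +-*-Solver
    T = a ∷ as

  Δ^p̂-suc : ∀ F a as j k → maximum (a ∷ as) ℕ.≤ k →
            Δₛ^ (suc j) (p̂ (suc F) (a ∷ as)) k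
            ≡ ∑ℚ (splittings (a ∷ as)) (λ s → Δₛ^ j (p̂? F (deleted s)) k + Δₛ^ j (p̂? F (lowered s)) k)
  Δ^p̂-suc F a as j k m≤k = begin
    Δₛ^ (suc j) (p̂ (suc F) T) k
      ≡⟨ Δₛ^-suc j (p̂ (suc F) T) k ⟩
    Δₛ^ j (Δₛ (p̂ (suc F) T)) k
      ≡⟨ Δₛ^-cong-≥ (maximum T) (Δp̂ F a as) j k m≤k ⟩
    Δₛ^ j (λ x → ι (childrenSum F T x)) k
      ≡⟨ Δₛ^-cong (λ x → trans (ι-∑ (splittings T) _) (∑ℚ-cong (splittings T) (λ s _ → ι-+ _ _))) j k ⟩
    Δₛ^ j (λ x → ∑ℚ (splittings T) (λ s → p̂? F (deleted s) x + p̂? F (lowered s) x)) k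
      ≡⟨ Δₛ^-∑ℚ (splittings T) (λ s x → p̂? F (deleted s) x + p̂? F (lowered s) x) j k ⟩
    ∑ℚ (splittings T) (λ s → Δₛ^ j (λ x → p̂? F (deleted s) x + p̂? F (lowered s) x) k)
      ≡⟨ ∑ℚ-cong (splittings T) (λ s _ → Δₛ^-+ (p̂? F (deleted s)) (p̂? F (lowered s)) j k) ⟩
    ∑ℚ (splittings T) (λ s → Δₛ^ j (p̂? F (deleted s)) k + Δₛ^ j (p̂? F (lowered s)) k) ∎
    where
    open ≡-Reasoning
    T = a ∷ as

  separated-weaken : ∀ {lo lo'} C → lo ℕ.≤ lo' → separatedᵇ lo' C ≡ true → separatedᵇ lo C ≡ true
  separated-weaken []      _    _  = refl
  separated-weaken {lo} {lo'} (c ∷ C) lo≤ sep with ∧-true⁻ {lo' ≤ᵇ c} sep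
  ... | lo'≤c , rest rewrite ≤ᵇ-true (ℕ.≤-trans lo≤ (≤ᵇ-sound {lo'} {c} lo'≤c)) = rest

  separated-map-pred : ∀ lo as → 1 ℕ.≤ lo → separatedᵇ lo as ≡ true → separatedᵇ (pred lo) (map pred as) ≡ true
  separated-map-pred lo []       _   _   = refl
  separated-map-pred lo (c ∷ cs) 1≤lo sep with ∧-true⁻ {lo ≤ᵇ c} sep
  ... | lo≤c , rest with ≤ᵇ-sound {lo} {c} lo≤c
  ... | lo≤c' rewrite ≤ᵇ-true (ℕ.pred-mono-≤ lo≤c') =
    separated-weaken (map pred cs) (s≤s (suc-pred≤ (ℕ.≤-trans 1≤lo lo≤c'))) (separated-map-pred (suc (suc c)) cs (s≤s z≤n) rest)
    where
    suc-pred≤ : ∀ {c} → 1 ℕ.≤ c → suc (pred c) ℕ.≤ c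
    suc-pred≤ {suc c} _ = ℕ.≤-refl

  -- Some child is separated and loses at most 1 from the maximum, unless T = [2]: for T = [a]
  -- take the child [a − 1] (or [] when a = 2), otherwise delete the first element.
  dominant-child : ∀ a as → Separated (a ∷ as) →
    Σ Splitting λ s → s ∈ splittings (a ∷ as) × Σ Bool λ b → Separated (childSet s b false) ×
      (pred (maximum (a ∷ as)) ℕ.≤ maximum (childSet s b false) ⊎ maximum (a ∷ as) ≡ 2)
  dominant-child (suc (suc zero)) [] _ = ([] , 2 , []) , here refl , false , refl , inj₂ refl
  dominant-child (suc (suc (suc a'))) [] _ = ([] , suc (suc (suc a')) , []) , here refl , true , refl ,
     inj₁ (subst (λ n → pred n ℕ.≤ maximum (suc (suc a') ∷ [])) (sym (ℕ.⊔-identityʳ (suc (suc (suc a'))))) (ℕ.m≤m⊔n (suc (suc a')) 0))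
  dominant-child a (b ∷ rest) sep with ∧-true⁻ {2 ≤ᵇ a} sep
  ... | 2≤a , sep' = ([] , a , b ∷ rest) , here refl , false ,
        separated-weaken (map pred (b ∷ rest)) (ℕ.≤-trans (≤ᵇ-sound {2} {a} 2≤a) (ℕ.n≤1+n a))
                         (separated-map-pred (suc (suc a)) (b ∷ rest) (s≤s z≤n) sep') ,
        inj₁ bound
    where
    T = a ∷ b ∷ rest
    a+2≤b : suc (suc a) ℕ.≤ b
    a+2≤b = All.head (separated-≥ _ (b ∷ rest) sep')
    bound : pred (maximum T) ℕ.≤ maximum (map pred (b ∷ rest))
    bound with maximum-∈ a (b ∷ rest)
    ... | here m≡a = contradiction (ℕ.≤-trans (ℕ.n≤1+n _) (ℕ.≤-trans a+2≤b
                                     (ℕ.≤-trans (All.lookup (≤-maximum T) (there (here refl))) (ℕ.≤-reflexive m≡a))))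
                                   (ℕ.<-irrefl refl)
    ... | there m∈ = All.lookup (≤-maximum (map pred (b ∷ rest))) (∈-map⁺ pred m∈)

  differenceSigns : ∀ F T → Separated T → maximum T ℕ.≤ F → DifferenceSigns F T
  differenceSigns F       []       _   _   = DifferenceSigns-[] F
  differenceSigns zero    (a ∷ as) sep m≤0 = contradiction (ℕ.≤-trans (separated-maximum a as sep) m≤0) λ ()
  differenceSigns (suc F) (a ∷ as) sep m≤F = record { Δ^-nonneg = nonneg ; Δ^-vanish = vanish ; Δ^-pos = pos ; value-pos = value }
    where
    T = a ∷ as
    m = maximum T
    2≤m = separated-maximum a as sep

    child≤ : ∀ b {s} → s ∈ splittings T → maximum (childSet s b false) ℕ.≤ pred m
    child≤ b s∈ = maximum-≤ _ (childSet-≤ T b sep s∈)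

    child≤k : ∀ b {s} k → s ∈ splittings T → m ℕ.≤ k → maximum (childSet s b false) ℕ.≤ k
    child≤k b k s∈ m≤k = ℕ.≤-trans (child≤ b s∈) (ℕ.≤-trans ℕ.pred[n]≤n m≤k)

    childSigns : ∀ b {s} → s ∈ splittings T → Separated (childSet s b false) → DifferenceSigns F (childSet s b false)
    childSigns b s∈ sep' = differenceSigns F _ sep' (ℕ.≤-trans (child≤ b s∈) (ℕ.pred-mono-≤ m≤F))

    term : ℕ → ℕ → Splitting → ℚ
    term j k s = Δₛ^ j (p̂? F (deleted s)) k + Δₛ^ j (p̂? F (lowered s)) k

    Δ^p̂?-child-nonneg : ∀ b j k {s} → s ∈ splittings T → m ℕ.≤ k → 0ℚ ≤ Δₛ^ j (p̂? F (childSet s b false)) k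
    Δ^p̂?-child-nonneg b j k s∈ m≤k = Δ^p̂?-nonneg F _ (childSigns b s∈) j k (child≤k b k s∈ m≤k)

    term-nonneg : ∀ j k → m ℕ.≤ k → ∀ s → s ∈ splittings T → 0ℚ ≤ term j k s
    term-nonneg j k m≤k s s∈ = 0≤+ (Δ^p̂?-child-nonneg false j k s∈ m≤k) (Δ^p̂?-child-nonneg true j k s∈ m≤k)

    nonneg : ∀ j k → m ℕ.≤ k → 0ℚ ≤ Δₛ^ j (p̂ (suc F) T) k
    nonneg zero     k m≤k = 0≤ι (peakPoly (suc F) T k)
    nonneg (suc j') k m≤k = subst (0ℚ ≤_) (sym (Δ^p̂-suc F a as j' k m≤k)) (0≤∑ℚ (splittings T) (term-nonneg j' k m≤k))

    vanish : ∀ j k → m ℕ.≤ k → m ℕ.≤ j → 1 ℕ.≤ j → Δₛ^ j (p̂ (suc F) T) k ≡ 0ℚ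
    vanish (suc j') k m≤k m≤j _ = trans (Δ^p̂-suc F a as j' k m≤k) (∑ℚ-zero (splittings T) λ s s∈ →
      trans (cong₂ _+_ (child-vanish false s∈) (child-vanish true s∈)) (ℚ.+-identityʳ 0ℚ))
      where
      child-vanish : ∀ b {s} → s ∈ splittings T → Δₛ^ j' (p̂? F (childSet s b false)) k ≡ 0ℚ
      child-vanish b s∈ = Δ^p̂?-vanish F _ (childSigns b s∈) j' k (child≤k b k s∈ m≤k)
                            (ℕ.≤-trans (child≤ b s∈) (ℕ.pred-mono-≤ m≤j)) (ℕ.pred-mono-≤ (ℕ.≤-trans 2≤m m≤j))

    dominant-pos : ∀ j' k b {s} → s ∈ splittings T → Separated (childSet s b false) →
                   (pred m ℕ.≤ maximum (childSet s b false) ⊎ m ≡ 2) → m ℕ.≤ k → suc (suc j') ℕ.≤ m →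
                   0ℚ < Δₛ^ j' (p̂? F (childSet s b false)) k
    dominant-pos j' k b {s} s∈ sep' large m≤k j'+2≤m rewrite sep' = go j' large j'+2≤m
      where
      C = childSet s b false
      signs = childSigns b s∈ sep'
      go : ∀ j' → (pred m ℕ.≤ maximum C ⊎ m ≡ 2) → suc (suc j') ℕ.≤ m → 0ℚ < Δₛ^ j' (p̂ F C) k
      go zero      _            _      = value-pos signs k (ℕ.≤-trans (s≤s (child≤ b s∈))
                                           (subst (ℕ._≤ k) (sym (ℕ.suc-pred m {{ℕ.>-nonZero (ℕ.≤-trans (s≤s z≤n) 2≤m)}})) m≤k))
      go (suc j'') (inj₁ m-1≤) j'+2≤m =
        Δ^-pos signs (suc j'') k (child≤k b k s∈ m≤k) (s≤s z≤n) (ℕ.≤-trans (ℕ.pred-mono-≤ j'+2≤m) m-1≤)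
      go (suc j'') (inj₂ m≡2)  j'+2≤m =
        contradiction (subst (3 ℕ.≤_) m≡2 (ℕ.≤-trans (s≤s (s≤s (s≤s z≤n))) j'+2≤m)) λ { (s≤s (s≤s ())) }

    pos : ∀ j k → m ℕ.≤ k → 1 ℕ.≤ j → suc j ℕ.≤ m → 0ℚ < Δₛ^ j (p̂ (suc F) T) k
    pos (suc j') k m≤k _ j+1≤m with dominant-child a as sep
    ... | s , s∈ , false , sep' , large = subst (0ℚ <_) (sym (Δ^p̂-suc F a as j' k m≤k)) (0<∑ℚ (splittings T) (term-nonneg j' k m≤k) s∈
          (0<+ˡ (dominant-pos j' k false s∈ sep' large m≤k j+1≤m) (Δ^p̂?-child-nonneg true j' k s∈ m≤k)))
    ... | s , s∈ , true  , sep' , large = subst (0ℚ <_) (sym (Δ^p̂-suc F a as j' k m≤k)) (0<∑ℚ (splittings T) (term-nonneg j' k m≤k) s∈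
          (0<+ʳ (Δ^p̂?-child-nonneg false j' k s∈ m≤k) (dominant-pos j' k true s∈ sep' large m≤k j+1≤m)))

    value : ∀ k → suc m ℕ.≤ k → 0ℚ < p̂ (suc F) T k
    value (suc k) (s≤s m≤k) = subst (0ℚ <_) (solve 2 (λ x y → (x :- y) :+ y := x) refl (p̂ (suc F) T (suc k)) (p̂ (suc F) T k))
                                (0<+ˡ (pos 1 k m≤k (s≤s z≤n) 2≤m) (0≤ι (peakPoly (suc F) T k)))
      where open +-*-Solver


module Polynomials where

  open import Data.Nat as ℕ using (ℕ; zero; suc; z≤n; s≤s)
  import Data.Nat.Properties as ℕ
  open import Data.Rational using (ℚ; 0ℚ; 1ℚ; _+_; _*_; _-_; -_; 1/_; NonZero)
  import Data.Rational.Properties as ℚ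
  open import Data.Rational.Solver using (module +-*-Solver)
  open import Data.List using ([]; _∷_; length)
  open import Data.Product using (_,_)
  open import Relation.Binary.PropositionalEquality using (_≡_; refl; sym; trans; cong; cong₂; subst; module ≡-Reasoning)
  open import Defs using (Poly; eval; Δ; Δ^)
  open +-*-Solver
  open NatEmbedding
  open FiniteDifferences

  ι-suc : ∀ k → ι k + 1ℚ ≡ ι (suc k)
  ι-suc k = sym (trans (cong ι (ℕ.+-comm 1 k)) (trans (ι-+ k 1) (cong (ι k +_) ι-1)))

  Δ^-ι : ∀ (f : ℚ → ℚ) j k → Δ^ j f (ι k) ≡ Δₛ^ j (λ n → f (ι n)) k
  Δ^-ι f zero    k = refl
  Δ^-ι f (suc j) k = cong₂ _-_ (trans (cong (Δ^ j f) (ι-suc k)) (Δ^-ι f j (suc k))) (Δ^-ι f j k)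

  _+ₚ_ : Poly → Poly → Poly
  []      +ₚ q       = q
  (c ∷ p) +ₚ []      = c ∷ p
  (c ∷ p) +ₚ (d ∷ q) = (c + d) ∷ (p +ₚ q)

  eval-+ₚ : ∀ p q x → eval (p +ₚ q) x ≡ eval p x + eval q x
  eval-+ₚ []      q       x = sym (ℚ.+-identityˡ _)
  eval-+ₚ (c ∷ p) []      x = sym (ℚ.+-identityʳ _)
  eval-+ₚ (c ∷ p) (d ∷ q) x rewrite eval-+ₚ p q x =
    solve 5 (λ c d x a b → (c :+ d) :+ x :* (a :+ b) := (c :+ x :* a) :+ (d :+ x :* b)) refl c d x (eval p x) (eval q x)

  _·ₚ_ : ℚ → Poly → Poly
  r ·ₚ []      = []
  r ·ₚ (c ∷ p) = (r * c) ∷ (r ·ₚ p)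

  eval-·ₚ : ∀ r p x → eval (r ·ₚ p) x ≡ r * eval p x
  eval-·ₚ r []      x = sym (ℚ.*-zeroʳ r)
  eval-·ₚ r (c ∷ p) x rewrite eval-·ₚ r p x = solve 4 (λ r c x e → r :* c :+ x :* (r :* e) := r :* (c :+ x :* e)) refl r c x (eval p x)

  -- x ↦ p(x + 1), by Horner's scheme: c + (x + 1) q(x + 1) = c + q' + x q'
  translate : Poly → Poly
  translate []      = []
  translate (c ∷ p) = (c ∷ []) +ₚ (translate p +ₚ (0ℚ ∷ translate p))

  eval-translate : ∀ p x → eval (translate p) x ≡ eval p (x + 1ℚ)
  eval-translate []      x = refl
  eval-translate (c ∷ p) x
    rewrite eval-+ₚ (c ∷ []) (translate p +ₚ (0ℚ ∷ translate p)) x | eval-+ₚ (translate p) (0ℚ ∷ translate p) x | eval-translate p x =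
    solve 3 (λ c x e → (c :+ x :* con 0ℚ) :+ (e :+ (con 0ℚ :+ x :* e)) := c :+ (x :+ con 1ℚ) :* e) refl c x (eval p (x + 1ℚ))

  Δₚ : Poly → Poly
  Δₚ p = translate p +ₚ ((- 1ℚ) ·ₚ p)

  eval-Δₚ : ∀ p x → eval (Δₚ p) x ≡ Δ (eval p) x
  eval-Δₚ p x rewrite eval-+ₚ (translate p) ((- 1ℚ) ·ₚ p) x | eval-·ₚ (- 1ℚ) p x | eval-translate p x =
    solve 2 (λ a b → a :+ (:- con 1ℚ) :* b := a :- b) refl (eval p (x + 1ℚ)) (eval p x)

  Δₚ^ : ℕ → Poly → Poly
  Δₚ^ zero    p = p
  Δₚ^ (suc j) p = Δₚ (Δₚ^ j p)

  eval-Δₚ^ : ∀ j p x → eval (Δₚ^ j p) x ≡ Δ^ j (eval p) x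
  eval-Δₚ^ zero    p x = refl
  eval-Δₚ^ (suc j) p x = trans (eval-Δₚ (Δₚ^ j p) x) (cong₂ _-_ (eval-Δₚ^ j p (x + 1ℚ)) (eval-Δₚ^ j p x))

  -- synthetic division by x − r
  quotient : ℚ → Poly → Poly
  quotient r []       = []
  quotient r (c ∷ cs) = cs +ₚ (r ·ₚ quotient r cs)

  eval-quotient : ∀ r p x → eval p x ≡ (x - r) * eval (quotient r p) x + eval p r
  eval-quotient r []       x = sym (trans (cong (_+ 0ℚ) (ℚ.*-zeroʳ (x - r))) (ℚ.+-identityʳ 0ℚ))
  eval-quotient r (c ∷ cs) x rewrite eval-+ₚ cs (r ·ₚ quotient r cs) x | eval-·ₚ r (quotient r cs) x | eval-quotient r cs x =
    solve 6 (λ c x r Q E Er → c :+ x :* ((x :- r) :* Q :+ Er) := (x :- r) :* ((x :- r) :* Q :+ Er :+ r :* Q) :+ (c :+ r :* Er)) refl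
      c x r (eval (quotient r cs) x) (eval cs x) (eval cs r)

  length-+ₚ : ∀ p q n → length p ℕ.≤ n → length q ℕ.≤ n → length (p +ₚ q) ℕ.≤ n
  length-+ₚ []      q       n       _         lq        = lq
  length-+ₚ (c ∷ p) []      n       lp        _         = lp
  length-+ₚ (c ∷ p) (d ∷ q) (suc n) (s≤s lp) (s≤s lq) = s≤s (length-+ₚ p q n lp lq)

  length-·ₚ : ∀ r p → length (r ·ₚ p) ≡ length p
  length-·ₚ r []      = refl
  length-·ₚ r (c ∷ p) = cong suc (length-·ₚ r p)

  length-quotient : ∀ r c cs → length (quotient r (c ∷ cs)) ℕ.≤ length cs
  length-quotient r c []       = z≤n
  length-quotient r c (d ∷ cs) = length-+ₚ (d ∷ cs) (r ·ₚ quotient r (d ∷ cs)) _ ℕ.≤-refl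
    (subst (ℕ._≤ length (d ∷ cs)) (sym (length-·ₚ r (quotient r (d ∷ cs)))) (ℕ.≤-trans (length-quotient r d cs) (ℕ.n≤1+n _)))

  *-cancelʳ : ∀ x y z .{{_ : NonZero z}} → x * z ≡ y * z → x ≡ y
  *-cancelʳ x y z eq = begin
      x                  ≡⟨ sym (ℚ.*-identityʳ x) ⟩
      x * 1ℚ             ≡⟨ cong (x *_) (sym (ℚ.*-inverseʳ z)) ⟩
      x * (z * 1/ z)     ≡⟨ sym (ℚ.*-assoc x z (1/ z)) ⟩
      (x * z) * 1/ z     ≡⟨ cong (_* 1/ z) eq ⟩
      (y * z) * 1/ z     ≡⟨ ℚ.*-assoc y z (1/ z) ⟩
      y * (z * 1/ z)     ≡⟨ cong (y *_) (ℚ.*-inverseʳ z) ⟩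
      y * 1ℚ             ≡⟨ ℚ.*-identityʳ y ⟩
      y                  ∎
    where open ≡-Reasoning

  -- divide by x − a and recurse on the degree
  vanishing-on-ℕ⇒zero : ∀ n p a → length p ℕ.≤ n → (∀ N → a ℕ.≤ N → eval p (ι N) ≡ 0ℚ) → ∀ x → eval p x ≡ 0ℚ
  vanishing-on-ℕ⇒zero n       []       a _          _      x = refl
  vanishing-on-ℕ⇒zero (suc n) (c ∷ cs) a (s≤s len≤) vanish x =
    trans (eval-quotient r p x) (trans (cong₂ _+_ (cong ((x - r) *_) (quotient-zero x)) (vanish a ℕ.≤-refl))
      (trans (cong (_+ 0ℚ) (ℚ.*-zeroʳ (x - r))) (ℚ.+-identityʳ 0ℚ)))
    where
    p = c ∷ cs
    r = ι a
    quotient-vanish : ∀ N → suc a ℕ.≤ N → eval (quotient r p) (ι N) ≡ 0ℚ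
    quotient-vanish N a<N with ℕ.m≤n⇒∃[o]m+o≡n a<N
    ... | o , refl = *-cancelʳ Q 0ℚ (ι (suc o)) {{ι-nonZero (suc o)}} (begin
      Q * ι (suc o)                           ≡⟨ ℚ.*-comm Q (ι (suc o)) ⟩
      ι (suc o) * Q                           ≡⟨ cong (_* Q) (sym gap) ⟩
      (ι N' - r) * Q                          ≡⟨ sym (ℚ.+-identityʳ _) ⟩
      (ι N' - r) * Q + 0ℚ                     ≡⟨ cong ((ι N' - r) * Q +_) (sym (vanish a ℕ.≤-refl)) ⟩
      (ι N' - r) * Q + eval p r               ≡⟨ sym (eval-quotient r p (ι N')) ⟩
      eval p (ι N')                           ≡⟨ vanish N' (ℕ.≤-trans (ℕ.n≤1+n a) a<N) ⟩
      0ℚ                                      ≡⟨ sym (ℚ.*-zeroˡ (ι (suc o))) ⟩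
      0ℚ * ι (suc o)                          ∎)
      where
      open ≡-Reasoning
      N' = suc a ℕ.+ o
      Q = eval (quotient r p) (ι N')
      gap : ι N' - r ≡ ι (suc o)
      gap = trans (cong (λ n → ι n - ι a) (sym (ℕ.+-suc a o)))
                  (trans (cong (_- ι a) (ι-+ a (suc o))) (solve 2 (λ x y → (x :+ y) :- x := y) refl (ι a) (ι (suc o))))
    quotient-zero : ∀ x → eval (quotient r p) x ≡ 0ℚ
    quotient-zero = vanishing-on-ℕ⇒zero n (quotient r p) (suc a) (ℕ.≤-trans (length-quotient r c cs) len≤) quotient-vanish


module PeakPolynomial where

  open import Data.Nat as ℕ using (ℕ; suc; _∸_; z≤n; s≤s)
  import Data.Nat.Properties as ℕ
  open import Data.Rational using (ℚ; 0ℚ; _*_; _<_)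
  import Data.Rational.Properties as ℚ
  open import Data.Bool using (true)
  open import Data.Bool.Properties using (⇔→≡) renaming (_≟_ to _≟ᵇ_)
  open import Data.List using (List; []; _∷_; length)
  open import Data.List.Membership.Propositional using (_∈_)
  open import Data.List.Membership.Propositional.Properties using (∈-filter⁺; ∈-filter⁻)
  open import Data.List.Relation.Unary.All using (All; []; _∷_)
  import Data.List.Relation.Unary.All as All
  open import Data.List.Relation.Unary.Linked using (Linked; []; [-]; _∷_)
  open import Data.List.Relation.Unary.AllPairs using (_∷_)
  open import Data.List.Relation.Unary.Unique.Propositional using (Unique)
  import Data.List.Relation.Unary.Unique.Propositional.Properties as Unique
  open import Data.List.Relation.Binary.Permutation.Propositional using (↭-sym; ↭⇒↭ₛ)
  open import Data.List.Relation.Binary.Permutation.Propositional.Properties using (∈-resp-↭; ↭-length)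
  import Data.List.Relation.Binary.Permutation.Setoid.Properties as Permutationₛ
  open import Data.List.Sort ℕ.≤-decTotalOrder using (sort; sort-↭; sort-↗)
  open import Data.Product using (_×_; _,_; proj₁)
  open import Data.Sum using (inj₁; inj₂)
  open import Function.Bundles using (mk⇔; Equivalence)
  open import Relation.Binary.PropositionalEquality using (_≡_; refl; sym; trans; cong; subst; setoid; module ≡-Reasoning)
  open import Relation.Nullary using (¬_)
  open import Defs
  open Permutations using (∈-permutations⁻; ∈-permutations⁺; permutations-unique)
  open PeakIndicator
  open PeakSets
  open PeakCounting
  open Splittings using (Separated; separatedᵇ)
  open CombinatorialPeakPolynomial
  open NatEmbedding
  open FiniteDifferences
  open PeakPolynomialDifferences
  open Polynomials

  HasPeakSet⇒HasPeaks : ∀ π {S T} → (∀ {a} → a ∈ S → a ∈ T) → (∀ {a} → a ∈ T → a ∈ S) → HasPeakSet π S → HasPeaks π T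
  HasPeakSet⇒HasPeaks π {T = T} S⊆T T⊆S h q = ⇔→≡ {z = true} (mk⇔
    (λ e → ∈⇒memᵇ q T (S⊆T (Equivalence.to (h q) (peakᵇ⇒IsPeak π q e))))
    (λ e → IsPeak⇒peakᵇ π q (Equivalence.from (h q) (T⊆S (memᵇ⇒∈ q T e)))))

  HasPeaks⇒HasPeakSet : ∀ π {S T} → (∀ {a} → a ∈ S → a ∈ T) → (∀ {a} → a ∈ T → a ∈ S) → HasPeaks π T → HasPeakSet π S
  HasPeaks⇒HasPeakSet π {T = T} S⊆T T⊆S h q = mk⇔
    (λ peak → T⊆S (memᵇ⇒∈ q T (trans (sym (h q)) (IsPeak⇒peakᵇ π q peak))))
    (λ q∈ → peakᵇ⇒IsPeak π q (trans (h q) (∈⇒memᵇ q T (S⊆T q∈))))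

  sorted-unique⇒increasing : ∀ lo xs → Linked ℕ._≤_ xs → Unique xs → All (lo ℕ.≤_) xs → IncreasingFrom lo xs
  sorted-unique⇒increasing lo []       _      _          _          = _
  sorted-unique⇒increasing lo (a ∷ as) sorted (a∉ ∷ u) (lo≤a ∷ _) = lo≤a , sorted-unique⇒increasing (suc a) as (tail sorted) u
    (All.zipWith (λ (a≤b , a≢b) → ℕ.≤∧≢⇒< a≤b a≢b) (above a as sorted , a∉))
    where
    tail : ∀ {a as} → Linked ℕ._≤_ (a ∷ as) → Linked ℕ._≤_ as
    tail [-]      = []
    tail (_ ∷ l) = l
    above : ∀ a as → Linked ℕ._≤_ (a ∷ as) → All (a ℕ.≤_) as
    above a []       _          = []
    above a (b ∷ bs) (a≤b ∷ l) = a≤b ∷ All.map (ℕ.≤-trans a≤b) (above b bs l)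

  length-separated : ∀ lo a as → separatedᵇ lo (a ∷ as) ≡ true → length (a ∷ as) ℕ.+ lo ℕ.≤ suc (maximum (a ∷ as))
  length-separated lo a []       sep = s≤s (ℕ.≤-trans (≤ᵇ-sound {lo} {a} (proj₁ (∧-true⁻ {lo ℕ.≤ᵇ a} sep))) (ℕ.m≤m⊔n a 0))
  length-separated lo a (b ∷ bs) sep with ∧-true⁻ {lo ℕ.≤ᵇ a} sep
  ... | lo≤a , rest = begin
    suc L ℕ.+ lo                ≤⟨ ℕ.+-monoʳ-≤ (suc L) (≤ᵇ-sound {lo} {a} lo≤a) ⟩
    suc L ℕ.+ a                 ≡⟨ sym (ℕ.+-suc L a) ⟩
    L ℕ.+ suc a                 ≤⟨ ℕ.≤-pred (subst (ℕ._≤ suc M) (ℕ.+-suc L (suc a)) (length-separated (suc (suc a)) b bs rest)) ⟩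
    M                           ≤⟨ ℕ.m≤n⊔m a M ⟩
    a ℕ.⊔ M                     ≤⟨ ℕ.n≤1+n _ ⟩
    suc (a ℕ.⊔ M)               ∎
    where
    open ℕ.≤-Reasoning
    L = length (b ∷ bs)
    M = maximum (b ∷ bs)

  length≤maximum : ∀ T → Separated T → length T ℕ.≤ maximum T
  length≤maximum []       _   = z≤n
  length≤maximum (a ∷ as) sep = ℕ.≤-trans (ℕ.m≤m+n (length (a ∷ as)) 1)
    (ℕ.≤-pred (subst (ℕ._≤ suc (maximum (a ∷ as))) (ℕ.+-suc (length (a ∷ as)) 1) (length-separated 2 a as sep)))

  module OfSet (S : List ℕ) (unique-S : Unique S) (π₀ : List ℕ) (peaks₀ : HasPeakSet π₀ S)
               (m : ℕ) (m∈S : m ∈ S) (S≤m : ∀ s → s ∈ S → s ℕ.≤ m) where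

    T : List ℕ
    T = sort S

    S⊆T : ∀ {a} → a ∈ S → a ∈ T
    S⊆T = ∈-resp-↭ (↭-sym (sort-↭ S))

    T⊆S : ∀ {a} → a ∈ T → a ∈ S
    T⊆S = ∈-resp-↭ (sort-↭ S)

    separated-T : Separated T
    separated-T = increasing-peaks⇒separated π₀ T (sorted-unique⇒increasing 0 T (sort-↗ S) unique-T (All.tabulate (λ _ → z≤n)))
      (λ {a} a∈ → trans (HasPeakSet⇒HasPeaks π₀ S⊆T T⊆S peaks₀ a) (∈⇒memᵇ a T a∈))
      where
      unique-T : Unique T
      unique-T = Permutationₛ.Unique-resp-↭ (setoid ℕ) (↭⇒↭ₛ (↭-sym (sort-↭ S))) unique-S

    maximum-T : maximum T ≡ m
    maximum-T = ℕ.≤-antisym (maximum-≤ T (All.tabulate (λ a∈ → S≤m _ (T⊆S a∈)))) (All.lookup (≤-maximum T) (S⊆T m∈S))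

    2≤m : 2 ℕ.≤ m
    2≤m = proj₁ (Equivalence.from (peaks₀ m) m∈S)

    signs : DifferenceSigns m T
    signs = differenceSigns m T separated-T (ℕ.≤-reflexive maximum-T)

    peakCount-T : ∀ N → suc m ℕ.≤ N → peakCount T N ℕ.* 2 ℕ.^ suc (length T) ≡ peakPoly m T N ℕ.* 2 ℕ.^ N
    peakCount-T N m<N = peakCount≡peakPoly m T separated-T m≥ N (ℕ.≤-trans m≥ (ℕ.≤-trans (ℕ.n≤1+n m) m<N)) (ℕ.≤-trans (s≤s z≤n) m<N)
      where m≥ = ℕ.≤-reflexive maximum-T

    peakCount-T≢0 : ∀ N → suc m ℕ.≤ N → ¬ peakCount T N ≡ 0
    peakCount-T≢0 N m<N count≡0 = ℚ.<-irrefl refl (subst (0ℚ <_) (trans (cong ι peakPoly≡0) ι-0)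
                                    (DifferenceSigns.value-pos signs N (subst (λ k → suc k ℕ.≤ N) (sym maximum-T) m<N)))
      where
      peakPoly≡0 : peakPoly m T N ≡ 0
      peakPoly≡0 = ℕ.m*n≡0⇒m≡0 _ (2 ℕ.^ N) {{ℕ.m^n≢0 2 N}} (trans (sym (peakCount-T N m<N)) (cong (ℕ._* _) count≡0))

    admissible-above : ∀ N → suc m ℕ.≤ N → Admissible S N
    admissible-above N m<N with peakCount≢0⇒∃ T N (peakCount-T≢0 N m<N)
    ... | σ , σ∈ , h = σ , ∈-permutations⁻ N σ∈ , HasPeaks⇒HasPeakSet σ S⊆T T⊆S h

    enumerates : ∀ N → Enumerates S N (withPeaks T N)
    enumerates N = Unique.filter⁺ has? (permutations-unique N) , λ π → mk⇔
      (λ π∈ → let (π∈N , h) = ∈-filter⁻ has? {xs = Permutations.permutations N} π∈ in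
              ∈-permutations⁻ N π∈N , HasPeaks⇒HasPeakSet π S⊆T T⊆S (hasPeaksᵇ-sound π T h))
      (λ (perm , h) → ∈-filter⁺ has? (∈-permutations⁺ N perm) (hasPeaksᵇ-complete π T (HasPeakSet⇒HasPeaks π S⊆T T⊆S h)))
      where has? = λ σ → hasPeaksᵇ σ T ≟ᵇ true

    module _ (p : Poly) (isPeakPoly : IsPeakPoly S p) where

      agrees-above : ∀ N → suc m ℕ.≤ N → eval p (ι N) ≡ p̂ m T N
      agrees-above N m<N = *-cancelʳ _ _ (ι (2 ℕ.^ N)) {{ι-nonZero (2 ℕ.^ N) {{ℕ.m^n≢0 2 N}}}} (begin
        eval p (ι N) * ι (2 ℕ.^ N)                          ≡⟨ cong (λ n → eval p (ι N) * ι n) 2^N≡ ⟩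
        eval p (ι N) * ι (2 ℕ.^ e ℕ.* 2 ℕ.^ suc k)          ≡⟨ cong (eval p (ι N) *_) (ι-* (2 ℕ.^ e) (2 ℕ.^ suc k)) ⟩
        eval p (ι N) * (ι (2 ℕ.^ e) * ι (2 ℕ.^ suc k))      ≡⟨ sym (ℚ.*-assoc (eval p (ι N)) _ _) ⟩
        eval p (ι N) * ι (2 ℕ.^ e) * ι (2 ℕ.^ suc k)        ≡⟨ cong (λ x → eval p (ι N) * x * ι (2 ℕ.^ suc k)) (sym (pow2≡ι e)) ⟩
        eval p (ι N) * pow2 e * ι (2 ℕ.^ suc k)             ≡⟨ cong (_* ι (2 ℕ.^ suc k)) (sym count≡) ⟩
        ι (peakCount T N) * ι (2 ℕ.^ suc k)                 ≡⟨ sym (ι-* (peakCount T N) (2 ℕ.^ suc k)) ⟩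
        ι (peakCount T N ℕ.* 2 ℕ.^ suc k)                   ≡⟨ cong ι (peakCount-T N m<N) ⟩
        ι (peakPoly m T N ℕ.* 2 ℕ.^ N)                      ≡⟨ ι-* (peakPoly m T N) (2 ℕ.^ N) ⟩
        p̂ m T N * ι (2 ℕ.^ N)                               ∎)
        where
        open ≡-Reasoning
        k = length T
        e = N ∸ length S ∸ 1
        k<N : suc k ℕ.≤ N
        k<N = ℕ.≤-trans (s≤s (subst (k ℕ.≤_) maximum-T (length≤maximum T separated-T))) m<N
        2^N≡ : 2 ℕ.^ N ≡ 2 ℕ.^ e ℕ.* 2 ℕ.^ suc k
        2^N≡ = begin
          2 ℕ.^ N                            ≡⟨ cong (2 ℕ.^_) (sym (ℕ.m∸n+n≡m k<N)) ⟩
          2 ℕ.^ (N ∸ suc k ℕ.+ suc k)        ≡⟨ cong (λ i → 2 ℕ.^ (N ∸ suc i ℕ.+ suc k)) (↭-length (sort-↭ S)) ⟩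
          2 ℕ.^ (N ∸ suc (length S) ℕ.+ suc k) ≡⟨ cong (λ i → 2 ℕ.^ (i ℕ.+ suc k))
                                                  (sym (trans (ℕ.∸-+-assoc N (length S) 1) (cong (N ∸_) (ℕ.+-comm (length S) 1)))) ⟩
          2 ℕ.^ (e ℕ.+ suc k)                ≡⟨ ℕ.^-distribˡ-+-* 2 e (suc k) ⟩
          2 ℕ.^ e ℕ.* 2 ℕ.^ suc k            ∎
        count≡ : ι (peakCount T N) ≡ eval p (ι N) * pow2 e
        count≡ = begin
          ι (peakCount T N)                  ≡⟨ cong ι (sym (length-withPeaks T N)) ⟩
          ι (length (withPeaks T N))         ≡⟨ ι≡ℕtoℚ _ ⟩
          ℕtoℚ (length (withPeaks T N))      ≡⟨ isPeakPoly N (admissible-above N m<N) (withPeaks T N) (enumerates N) ⟩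
          eval p (ℕtoℚ N) * pow2 e           ≡⟨ cong (λ x → eval p x * pow2 e) (sym (ι≡ℕtoℚ N)) ⟩
          eval p (ι N) * pow2 e              ∎

      Δ^m-vanishes : ∀ x → Δ^ m (eval p) x ≡ 0ℚ
      Δ^m-vanishes x = trans (sym (eval-Δₚ^ m p x)) (vanishing-on-ℕ⇒zero (length (Δₚ^ m p)) (Δₚ^ m p) (suc m) ℕ.≤-refl vanish x)
        where
        vanish : ∀ N → suc m ℕ.≤ N → eval (Δₚ^ m p) (ι N) ≡ 0ℚ
        vanish N m<N = begin
          eval (Δₚ^ m p) (ι N)               ≡⟨ eval-Δₚ^ m p (ι N) ⟩
          Δ^ m (eval p) (ι N)                ≡⟨ Δ^-ι (eval p) m N ⟩
          Δₛ^ m (λ n → eval p (ι n)) N       ≡⟨ Δₛ^-cong-≥ (suc m) agrees-above m N m<N ⟩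
          Δₛ^ m (p̂ m T) N                    ≡⟨ DifferenceSigns.Δ^-vanish signs m N max≤N max≤m (ℕ.≤-trans (s≤s z≤n) 2≤m) ⟩
          0ℚ                                 ∎
          where
          open ≡-Reasoning
          max≤m = ℕ.≤-reflexive maximum-T
          max≤N = ℕ.≤-trans max≤m (ℕ.≤-trans (ℕ.n≤1+n m) m<N)

      agrees : ∀ N → m ℕ.≤ N → eval p (ι N) ≡ p̂ m T N
      agrees N m≤N with ℕ.m≤n⇒m<n∨m≡n m≤N
      ... | inj₁ m<N  = agrees-above N m<N
      ... | inj₂ refl = agreement-at-threshold m agrees-above m (begin
        Δₛ^ m (λ n → eval p (ι n)) m       ≡⟨ sym (Δ^-ι (eval p) m m) ⟩
        Δ^ m (eval p) (ι m)                ≡⟨ Δ^m-vanishes (ι m) ⟩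
        0ℚ                                 ≡⟨ sym (DifferenceSigns.Δ^-vanish signs m m max≤m max≤m (ℕ.≤-trans (s≤s z≤n) 2≤m)) ⟩
        Δₛ^ m (p̂ m T) m                    ∎)
        where
        open ≡-Reasoning
        max≤m = ℕ.≤-reflexive maximum-T

      Δ^-positive : ∀ j k → 1 ℕ.≤ j → j ℕ.≤ m ∸ 1 → m ℕ.≤ k → 0ℚ < Δ^ j (eval p) (ℕtoℚ k)
      Δ^-positive j k 1≤j j≤m-1 m≤k = subst (λ x → 0ℚ < Δ^ j (eval p) x) (ι≡ℕtoℚ k)
        (subst (0ℚ <_) (sym (trans (Δ^-ι (eval p) j k) (Δₛ^-cong-≥ m agrees j k m≤k)))
          (DifferenceSigns.Δ^-pos signs j k (subst (ℕ._≤ k) (sym maximum-T) m≤k) 1≤j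
            (subst (suc j ℕ.≤_) (sym maximum-T)
              (ℕ.≤-trans (s≤s j≤m-1) (ℕ.≤-reflexive (ℕ.suc-pred m {{ℕ.>-nonZero (ℕ.≤-trans (s≤s z≤n) 2≤m)}}))))))


open import Defs
open import Data.Nat using (ℕ; _≤_; _∸_)
open import Data.Rational using (ℚ; 0ℚ; _<_)
open import Data.List using (List)
open import Data.List.Membership.Propositional using (_∈_)
open import Data.List.Relation.Unary.Unique.Propositional using (Unique)
open import Data.Product using (_×_; _,_)
open import Relation.Binary.PropositionalEquality using (_≡_)

theorem1 : (n : ℕ) → 1 ≤ n → (S : List ℕ) → Unique S
    → (∀ s → s ∈ S → (1 ≤ s) × (s ≤ n)) → Admissible S n
    → (m : ℕ) → m ∈ S → (∀ s → s ∈ S → s ≤ m)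
    → (p : Poly) → IsPeakPoly S p
    → ((j k : ℕ) → 1 ≤ j → j ≤ m ∸ 1 → m ≤ k → 0ℚ < Δ^ j (eval p) (ℕtoℚ k))
    × ((x : ℚ) → Δ^ m (eval p) x ≡ 0ℚ)
theorem1 _ _ S unique-S _ (π₀ , _ , peaks₀) m m∈S S≤m p isPeakPoly = Δ^-positive p isPeakPoly , Δ^m-vanishes p isPeakPoly
  where open PeakPolynomial.OfSet S unique-S π₀ peaks₀ m m∈S S≤m
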